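{- For every integer $b\ge2$, the spider $\mathcal S_{2,b}$ has no Braess edges, i.e. $B(\mathcal S_{2,b})=0$.
   Context: The spider $\mathcal S_{a,b}$ ($a\ge1$, $b\ge2$) is the tree consisting of $b$ paths, each with $a$ edges, sharing one common endpoint (the center). For a connected graph $G$, $\kappa(G)$ is Kemeny's constant of the simple random walk on $G$: $\kappa(G)=\sum_{j\ne i}m_{ij}\pi_j$ ($m_{ij}$ mean first passage time, $\pi$ stationary distribution). A pair of nonadjacent vertices is a Braess edge of $G$ if adding the edge between them strictly increases $\kappa$; $B(G)$ denotes the number of Braess edges of $G$. -}

module Defs where

open import Data.Nat as ℕ using (ℕ; zero; suc)
open import Data.Integer using (+_)
open import Data.Rational as ℚ using (ℚ; 0ℚ; 1ℚ; _/_)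
open import Data.Fin using (Fin; zero; suc; toℕ)
open import Data.Fin.Properties using (_≟_)
open import Data.Bool using (Bool; true; false; _∨_; _∧_; if_then_else_)
open import Data.Product using (Σ; _×_; ∃)
open import Relation.Binary.PropositionalEquality using (_≡_; _≢_)
open import Relation.Nullary.Decidable using (⌊_⌋)

-- A (simple, undirected) graph on the vertex set Fin n, given by its
-- adjacency relation (symmetric and irreflexive for all graphs used below).
Graph : ℕ → Set
Graph n = Fin n → Fin n → Bool

sumℕ : ∀ {n} → (Fin n → ℕ) → ℕ
sumℕ {zero} f = 0
sumℕ {suc n} f = f zero ℕ.+ sumℕ (λ i → f (suc i))

sumℚ : ∀ {n} → (Fin n → ℚ) → ℚ
sumℚ {zero} f = 0ℚ
sumℚ {suc n} f = f zero ℚ.+ sumℚ (λ i → f (suc i))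

sumℚ-except : ∀ {n} → Fin n → (Fin n → ℚ) → ℚ
sumℚ-except j f = sumℚ (λ k → if ⌊ k ≟ j ⌋ then 0ℚ else f k)

ℕtoℚ : ℕ → ℚ
ℕtoℚ k = (+ k) / 1

-- 1/k, with the (never used) convention 1/0 = 0
invℕ : ℕ → ℚ
invℕ zero = 0ℚ
invℕ (suc k) = (+ 1) / suc k

degree : ∀ {n} → Graph n → Fin n → ℕ
degree G i = sumℕ (λ k → if G i k then 1 else 0)

P : ∀ {n} → Graph n → Fin n → Fin n → ℚ
P G i k = (if G i k then 1ℚ else 0ℚ) ℚ.* invℕ (degree G i)

π : ∀ {n} → Graph n → Fin n → ℚ
π G j = ℕtoℚ (degree G j) ℚ.* invℕ (sumℕ (degree G))

-- m is a matrix of mean first passage times of the random walk on G: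
-- for i ≠ j, m_ij = 1 + Σ_{k ≠ j} P_ik m_kj  (first-step analysis; for a
-- connected graph this system has a unique solution, the mean first
-- passage times).
IsMFPT : ∀ {n} → Graph n → (Fin n → Fin n → ℚ) → Set
IsMFPT G m = ∀ i j → i ≢ j →
  m i j ≡ 1ℚ ℚ.+ sumℚ-except j (λ k → P G i k ℚ.* m k j)

IsKemeny : ∀ {n} → Graph n → ℚ → Set
IsKemeny G κ = ∃ λ m → IsMFPT G m ×
  (∀ i → sumℚ-except i (λ j → m i j ℚ.* π G j) ≡ κ)

addEdge : ∀ {n} → Graph n → Fin n → Fin n → Graph n
addEdge G u v x y =
  G x y ∨ (⌊ x ≟ u ⌋ ∧ ⌊ y ≟ v ⌋) ∨ (⌊ x ≟ v ⌋ ∧ ⌊ y ≟ u ⌋)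

IsBraess : ∀ {n} → Graph n → Fin n → Fin n → Set
IsBraess G u v = u ≢ v × G u v ≡ false ×
  Σ ℚ λ κ → Σ ℚ λ κ' → IsKemeny G κ × IsKemeny (addEdge G u v) κ' × κ ℚ.< κ'

-- Spider S_{2,b} on vertices 0 .. 2b: 0 is the center, leg l (1 ≤ l ≤ b)
-- is the path 0 — l — l+b.
spiderAdjℕ : ℕ → ℕ → ℕ → Bool
spiderAdjℕ b x y =
  (⌊ x ℕ.≟ 0 ⌋ ∧ ⌊ 1 ℕ.≤? y ⌋ ∧ ⌊ y ℕ.≤? b ⌋)
  ∨ (⌊ 1 ℕ.≤? x ⌋ ∧ ⌊ x ℕ.≤? b ⌋ ∧ ⌊ y ℕ.≟ x ℕ.+ b ⌋)

spider2 : (b : ℕ) → Graph (suc (2 ℕ.* b))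
spider2 b x y = spiderAdjℕ b (toℕ x) (toℕ y) ∨ spiderAdjℕ b (toℕ y) (toℕ x)

{-# OPTIONS --safe #-}
-- Kemeny's constant is read off the row of the centre c: κ = Σⱼ π_j h(c, j), where h(c, j)
-- is the hitting time of j. Hitting times towards j are pinned down by the first-step
-- equations together with Kac's formula Σ_{k ~ j} h(k, j) = D − d_j (D = 2|E|), which
-- follows from stationarity of π. On a leg c — x — y this gives h(c, x) = D − 3 and
-- h(c, y) = 2D − 4, so every leg contributes 4D − 10 to D·κ and κ(S_{2,b}) = 4b − 5/2.
-- Adding a non-edge changes one or two legs only (four shapes up to symmetry: a triangle
-- at c, two legs bridged at their middles, a middle joined to another leaf, two leaves
-- joined); solving the corresponding small linear systems gives their contribution, and
-- in each case κ decreases by a nonnegative multiple of 1/D′.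
module Submission where

open import Agda.Builtin.FromNat using (Number; fromNat)
open import Agda.Builtin.FromNeg using (Negative; fromNeg)
open import Algebra.Bundles using (CommutativeMonoid; CommutativeRing)
open import Algebra.Core using (Op₂)
open import Algebra.Structures using (IsCommutativeMonoid)
open import Data.Bool using (Bool; true; false; T; _∨_; _∧_; if_then_else_)
open import Data.Bool.Properties using (T-≡; T-∨; T-∧; ∨-comm; ∧-comm; ∨-identityʳ; ∨-zeroʳ; ¬-not)
open import Data.Empty using (⊥; ⊥-elim)
open import Data.Fin as Fin using (Fin; zero; suc; toℕ; _↑ˡ_; _↑ʳ_; splitAt)
open import Data.Fin.Properties as Fin using (_≟_; toℕ-injective; toℕ-↑ˡ; toℕ-↑ʳ)
import Data.Integer as ℤ
import Data.Integer.Literals as ℤ-Literals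
import Data.Integer.Properties as ℤ
open import Data.List using (List; []; _∷_; foldr; length)
open import Data.List.Membership.Propositional using (_∈_; _∉_)
import Data.List.Relation.Unary.All as All
open All using (All)
import Data.List.Relation.Unary.AllPairs as AllPairs
open import Data.List.Relation.Unary.Any using (here; there)
open import Data.List.Relation.Unary.Unique.Propositional using (Unique)
open import Data.Nat as ℕ using (ℕ; zero; suc; _≤_; z≤n; s≤s)
import Data.Nat.Coprimality as Coprimality
import Data.Nat.Literals as ℕ-Literals
open import Data.Nat.Properties as ℕ using ()
open import Data.Nat.Tactic.RingSolver using () renaming (solve-∀ to ℕ-solve-∀)
open import Data.Product using (_×_; _,_; ∃; proj₁; proj₂; map₂; uncurry)
open import Data.Product.Function.NonDependent.Propositional using (_×-⇔_)
open import Data.Rational as ℚ using (ℚ; mkℚ; 0ℚ; 1ℚ; _+_; _*_; _-_; _/_)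
import Data.Rational.Literals as ℚ-Literals
open import Data.Rational.Properties as ℚ using ()
import Algebra.Properties.Semiring.Sum as SemiringSum
open import Data.Sum using (_⊎_; inj₁; inj₂)
open import Data.Sum.Function.Propositional using (_⊎-⇔_)
open import Data.Unit using (tt)
open import Function using (_∘_; _⇔_; mk⇔; Equivalence)
import Function.Properties.Equivalence as ⇔
open import Level using (0ℓ)
open import Relation.Binary.PropositionalEquality
open import Relation.Nullary using (¬_; Dec; yes; no)
open import Relation.Nullary.Decidable
  using (⌊_⌋; isYes≗does; dec-true; dec-false; dec⇒maybe; toWitness; fromWitness)
open import Tactic.RingSolver using (solve)
open import Tactic.RingSolver.Core.AlmostCommutativeRing using (AlmostCommutativeRing; fromCommutativeRing)

open import Defs

instance
  ℕ-number : Number ℕ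
  ℕ-number = ℕ-Literals.number
  ℤ-number : Number ℤ.ℤ
  ℤ-number = ℤ-Literals.number
  ℤ-negative : Negative ℤ.ℤ
  ℤ-negative = ℤ-Literals.negative
  ℚ-number : Number ℚ
  ℚ-number = ℚ-Literals.number
  ℚ-negative : Negative ℚ
  ℚ-negative = ℚ-Literals.negative

ℚ-ring : AlmostCommutativeRing 0ℓ 0ℓ
ℚ-ring = fromCommutativeRing ℚ.+-*-commutativeRing (λ x → dec⇒maybe (0ℚ ℚ.≟ x))

infixl 6 _⊕_
infixl 7 _⋆_

_⋆_ : ∀ (c : ℚ) {a b : ℚ} → a ≡ b → c * a ≡ c * b
c ⋆ a≡b = cong (c *_) a≡b

_⊕_ : ∀ {a b a′ b′ : ℚ} → a ≡ b → a′ ≡ b′ → a + a′ ≡ b + b′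
_⊕_ = cong₂ _+_

-- To derive x ≡ y from hypotheses hᵢ : aᵢ ≡ bᵢ, pass the combination c₁ ⋆ h₁ ⊕ … ⊕ cₙ ⋆ hₙ
-- and let the ring solver check x − y = Σ cᵢ (aᵢ − bᵢ).
linear-combination : ∀ {x y l r : ℚ} → l ≡ r → x - y ≡ l - r → x ≡ y
linear-combination {x} {y} {l} {r} l≡r eq = begin
  x            ≡⟨ solve (x ∷ y ∷ []) ℚ-ring ⟩
  (x - y) + y  ≡⟨ cong (_+ y) eq ⟩
  (l - r) + y  ≡⟨ cong (λ z → (l - z) + y) (sym l≡r) ⟩
  (l - l) + y  ≡⟨ solve (l ∷ y ∷ []) ℚ-ring ⟩
  y            ∎
  where open ≡-Reasoning

ℕtoℚ≡mkℚ : ∀ k → ℕtoℚ k ≡ mkℚ (ℤ.+ k) 0 (Coprimality.sym (Coprimality.1-coprimeTo k))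
ℕtoℚ≡mkℚ k = ℚ.normalize-coprime _

invℕ≡mkℚ : ∀ k → invℕ (suc k) ≡ mkℚ (ℤ.+ 1) k (Coprimality.1-coprimeTo (suc k))
invℕ≡mkℚ k = ℚ.normalize-coprime _

ℕtoℚ-+ : ∀ m n → ℕtoℚ (m ℕ.+ n) ≡ ℕtoℚ m + ℕtoℚ n
ℕtoℚ-+ m n rewrite ℕtoℚ≡mkℚ m | ℕtoℚ≡mkℚ n =
  cong (_/ 1) (sym (cong₂ ℤ._+_ (ℤ.*-identityʳ (ℤ.+ m)) (ℤ.*-identityʳ (ℤ.+ n))))

ℕtoℚ-* : ∀ m n → ℕtoℚ (m ℕ.* n) ≡ ℕtoℚ m * ℕtoℚ n
ℕtoℚ-* m n rewrite ℕtoℚ≡mkℚ m | ℕtoℚ≡mkℚ n = cong (_/ 1) (ℤ.pos-* m n)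

ℕtoℚ*invℕ : ∀ k → ℕtoℚ (suc k) * invℕ (suc k) ≡ 1ℚ
ℕtoℚ*invℕ k rewrite ℕtoℚ≡mkℚ (suc k) | invℕ≡mkℚ k =
  ℚ.*-inverseʳ (mkℚ (ℤ.+ suc k) 0 (Coprimality.sym (Coprimality.1-coprimeTo (suc k))))

0≤ℕtoℚ : ∀ k → 0ℚ ℚ.≤ ℕtoℚ k
0≤ℕtoℚ k = ℚ.nonNegative⁻¹ (ℕtoℚ k) {{ℚ.normalize-nonNeg k 1}}

0≤invℕ : ∀ k → 0ℚ ℚ.≤ invℕ k
0≤invℕ zero = ℚ.≤-refl
0≤invℕ (suc k) = ℚ.nonNegative⁻¹ (invℕ (suc k)) {{ℚ.normalize-nonNeg 1 (suc k)}}

0≤* : ∀ {p q} → 0ℚ ℚ.≤ p → 0ℚ ℚ.≤ q → 0ℚ ℚ.≤ p * q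
0≤* {p} {q} 0≤p 0≤q =
  ℚ.nonNegative⁻¹ (p * q) {{ℚ.nonNeg*nonNeg⇒nonNeg p {{ℚ.nonNegative 0≤p}} q {{ℚ.nonNegative 0≤q}}}}

0≤+ : ∀ {p q} → 0ℚ ℚ.≤ p → 0ℚ ℚ.≤ q → 0ℚ ℚ.≤ p + q
0≤+ {p} {q} 0≤p 0≤q =
  ℚ.nonNegative⁻¹ (p + q) {{ℚ.nonNeg+nonNeg⇒nonNeg p {{ℚ.nonNegative 0≤p}} q {{ℚ.nonNegative 0≤q}}}}

⌊⌋-true : ∀ {A : Set} (a? : Dec A) → A → ⌊ a? ⌋ ≡ true
⌊⌋-true a? a = trans (isYes≗does a?) (dec-true a? a)

⌊⌋-false : ∀ {A : Set} (a? : Dec A) → ¬ A → ⌊ a? ⌋ ≡ false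
⌊⌋-false a? ¬a = trans (isYes≗does a?) (dec-false a? ¬a)

indicator : Bool → ℕ
indicator a = if a then 1 else 0

-- Σ is any operator obeying the defining equations of sumℕ and sumℚ from Defs; through Σ≡sum
-- the lemmas are transported from the library's sum.
module FinSum {A : Set} {_∙_ : Op₂ A} {ε : A}
  (isCommutativeMonoid : IsCommutativeMonoid _≡_ _∙_ ε)
  (Σ : ∀ {n} → (Fin n → A) → A)
  (Σ-[] : (f : Fin 0 → A) → Σ f ≡ ε)
  (Σ-∷ : ∀ {n} (f : Fin (suc n) → A) → Σ f ≡ f zero ∙ Σ (f ∘ suc))
  where

  open IsCommutativeMonoid isCommutativeMonoid using (assoc; comm; identityˡ; identityʳ)
  private
    monoid : CommutativeMonoid 0ℓ 0ℓ
    monoid = record { isCommutativeMonoid = isCommutativeMonoid }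
  open import Algebra.Properties.CommutativeMonoid.Sum monoid
    using (sum; sum-cong-≗; ∑-distrib-+; ∑-comm)
  open ≡-Reasoning

  Σ≡sum : ∀ {n} (f : Fin n → A) → Σ f ≡ sum f
  Σ≡sum {zero} f = Σ-[] f
  Σ≡sum {suc n} f = trans (Σ-∷ f) (cong (f zero ∙_) (Σ≡sum (f ∘ suc)))

  Σ-cong : ∀ {n} {f g : Fin n → A} → (∀ i → f i ≡ g i) → Σ f ≡ Σ g
  Σ-cong {f = f} {g} f≗g = trans (Σ≡sum f) (trans (sum-cong-≗ f≗g) (sym (Σ≡sum g)))

  Σ-distrib : ∀ {n} (f g : Fin n → A) → Σ (λ i → f i ∙ g i) ≡ Σ f ∙ Σ g
  Σ-distrib f g = begin
    Σ (λ i → f i ∙ g i)  ≡⟨ Σ≡sum _ ⟩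
    sum (λ i → f i ∙ g i) ≡⟨ ∑-distrib-+ f g ⟩
    sum f ∙ sum g         ≡⟨ cong₂ _∙_ (Σ≡sum f) (Σ≡sum g) ⟨
    Σ f ∙ Σ g             ∎

  Σ-comm : ∀ {m n} (f : Fin m → Fin n → A) → Σ (λ i → Σ (f i)) ≡ Σ (λ j → Σ (λ i → f i j))
  Σ-comm f = begin
    Σ (λ i → Σ (f i))                ≡⟨ Σ≡sum _ ⟩
    sum (λ i → Σ (f i))              ≡⟨ sum-cong-≗ (Σ≡sum ∘ f) ⟩
    sum (λ i → sum (f i))            ≡⟨ ∑-comm f ⟩
    sum (λ j → sum (λ i → f i j))    ≡⟨ sum-cong-≗ (λ j → Σ≡sum (λ i → f i j)) ⟨
    sum (λ j → Σ (λ i → f i j))      ≡⟨ Σ≡sum _ ⟨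
    Σ (λ j → Σ (λ i → f i j))        ∎

  Σ-zero : ∀ {n} {f : Fin n → A} → (∀ i → f i ≡ ε) → Σ f ≡ ε
  Σ-zero {zero} {f} _ = Σ-[] f
  Σ-zero {suc n} {f} f≗ε = begin
    Σ f                  ≡⟨ Σ-∷ f ⟩
    f zero ∙ Σ (f ∘ suc) ≡⟨ cong₂ _∙_ (f≗ε zero) (Σ-zero (f≗ε ∘ suc)) ⟩
    ε ∙ ε                ≡⟨ identityˡ ε ⟩
    ε                    ∎

  Σ-split : ∀ m {k} (f : Fin (m ℕ.+ k) → A) → Σ f ≡ Σ (λ i → f (i ↑ˡ k)) ∙ Σ (λ i → f (m ↑ʳ i))
  Σ-split zero f = begin
    Σ f       ≡⟨ identityˡ (Σ f) ⟨
    ε ∙ Σ f   ≡⟨ cong (_∙ Σ f) (Σ-[] _) ⟨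
    Σ (λ i → f (i ↑ˡ _)) ∙ Σ f ∎
  Σ-split (suc m) f = begin
    Σ f                                                     ≡⟨ Σ-∷ f ⟩
    f zero ∙ Σ (f ∘ suc)                                    ≡⟨ cong (f zero ∙_) (Σ-split m (f ∘ suc)) ⟩
    f zero ∙ (Σ (λ i → f (suc (i ↑ˡ _))) ∙ Σ (λ i → f (suc (m ↑ʳ i)))) ≡⟨ assoc _ _ _ ⟨
    (f zero ∙ Σ (λ i → f (suc (i ↑ˡ _)))) ∙ Σ (λ i → f (suc (m ↑ʳ i))) ≡⟨ cong (_∙ _) (Σ-∷ _) ⟨
    Σ (λ i → f (i ↑ˡ _)) ∙ Σ (λ i → f (suc m ↑ʳ i))         ∎

  Σ-double : ∀ m (f : Fin (m ℕ.+ (m ℕ.+ 0)) → A) → Σ f ≡ Σ (λ i → f (i ↑ˡ (m ℕ.+ 0)) ∙ f (m ↑ʳ (i ↑ˡ 0)))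
  Σ-double m f = begin
    Σ f                                                    ≡⟨ Σ-split m f ⟩
    Σ (λ i → f (i ↑ˡ _)) ∙ Σ (λ i → f (m ↑ʳ i))            ≡⟨ cong (Σ (λ i → f (i ↑ˡ _)) ∙_) (Σ-split m (λ i → f (m ↑ʳ i))) ⟩
    Σ (λ i → f (i ↑ˡ _)) ∙ (Σ (λ i → f (m ↑ʳ (i ↑ˡ 0))) ∙ Σ (λ i → f (m ↑ʳ (m ↑ʳ i))))
      ≡⟨ cong (λ s → Σ (λ i → f (i ↑ˡ _)) ∙ (Σ (λ i → f (m ↑ʳ (i ↑ˡ 0))) ∙ s)) (Σ-[] _) ⟩
    Σ (λ i → f (i ↑ˡ _)) ∙ (Σ (λ i → f (m ↑ʳ (i ↑ˡ 0))) ∙ ε) ≡⟨ cong (Σ (λ i → f (i ↑ˡ _)) ∙_) (identityʳ _) ⟩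
    Σ (λ i → f (i ↑ˡ _)) ∙ Σ (λ i → f (m ↑ʳ (i ↑ˡ 0)))     ≡⟨ Σ-distrib _ _ ⟨
    Σ (λ i → f (i ↑ˡ (m ℕ.+ 0)) ∙ f (m ↑ʳ (i ↑ˡ 0)))       ∎

  Σ-extract : ∀ {n} (f : Fin n → A) a → Σ f ≡ f a ∙ Σ (λ k → if ⌊ k ≟ a ⌋ then ε else f k)
  Σ-extract f zero = begin
    Σ f                  ≡⟨ Σ-∷ f ⟩
    f zero ∙ Σ (f ∘ suc) ≡⟨ cong (f zero ∙_) (identityˡ _) ⟨
    f zero ∙ (ε ∙ Σ (f ∘ suc)) ≡⟨ cong (f zero ∙_) (Σ-∷ _) ⟨
    f zero ∙ Σ (λ k → if ⌊ k ≟ zero ⌋ then ε else f k) ∎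
  Σ-extract {suc n} f (suc a) = begin
    Σ f                         ≡⟨ Σ-∷ f ⟩
    f zero ∙ Σ (f ∘ suc)        ≡⟨ cong (f zero ∙_) (Σ-extract (f ∘ suc) a) ⟩
    f zero ∙ (f (suc a) ∙ Σ f′) ≡⟨ assoc _ _ _ ⟨
    (f zero ∙ f (suc a)) ∙ Σ f′ ≡⟨ cong (_∙ Σ f′) (comm _ _) ⟩
    (f (suc a) ∙ f zero) ∙ Σ f′ ≡⟨ assoc _ _ _ ⟩
    f (suc a) ∙ (f zero ∙ Σ f′) ≡⟨ cong (λ s → f (suc a) ∙ (f zero ∙ s)) (Σ-cong f′≗) ⟩
    f (suc a) ∙ (f zero ∙ Σ (f″ ∘ suc)) ≡⟨ cong (f (suc a) ∙_) (Σ-∷ f″) ⟨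
    f (suc a) ∙ Σ f″            ∎
    where
    f′ : Fin n → A
    f′ k = if ⌊ k ≟ a ⌋ then ε else f (suc k)
    f″ : Fin (suc n) → A
    f″ k = if ⌊ k ≟ suc a ⌋ then ε else f k
    f′≗ : ∀ k → f′ k ≡ f″ (suc k)
    f′≗ k with k ≟ a
    ... | yes _ = refl
    ... | no _ = refl

  listΣ : ∀ {n} → (Fin n → A) → List (Fin n) → A
  listΣ f = foldr (λ k → f k ∙_) ε

  listΣ-cong : ∀ {n} {f g : Fin n → A} {ks} → All (λ k → f k ≡ g k) ks → listΣ f ks ≡ listΣ g ks
  listΣ-cong All.[] = refl
  listΣ-cong (f≡g All.∷ fs≡gs) = cong₂ _∙_ f≡g (listΣ-cong fs≡gs)

  Σ-sparse : ∀ {n} (f : Fin n → A) {ks} → Unique ks → (∀ k → k ∉ ks → f k ≡ ε) → Σ f ≡ listΣ f ks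
  Σ-sparse f {[]} AllPairs.[] vanishes = Σ-zero (λ k → vanishes k λ ())
  Σ-sparse f {a ∷ ks} (a∉ks AllPairs.∷ unique) vanishes = begin
    Σ f               ≡⟨ Σ-extract f a ⟩
    f a ∙ Σ f′        ≡⟨ cong (f a ∙_) (Σ-sparse f′ unique vanishes′) ⟩
    f a ∙ listΣ f′ ks ≡⟨ cong (f a ∙_) (listΣ-cong (All.map f′≡f a∉ks)) ⟩
    f a ∙ listΣ f ks  ∎
    where
    f′ : Fin _ → A
    f′ k = if ⌊ k ≟ a ⌋ then ε else f k
    f′≡f : ∀ {k} → a ≢ k → f′ k ≡ f k
    f′≡f {k} a≢k with k ≟ a
    ... | yes k≡a = ⊥-elim (a≢k (sym k≡a))
    ... | no _ = refl
    vanishes′ : ∀ k → k ∉ ks → f′ k ≡ ε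
    vanishes′ k k∉ks with k ≟ a
    ... | yes _ = refl
    ... | no k≢a = vanishes k λ { (here k≡a) → k≢a k≡a ; (there k∈ks) → k∉ks k∈ks }

module ℕΣ = FinSum ℕ.+-0-isCommutativeMonoid sumℕ (λ _ → refl) (λ _ → refl)
module ℚΣ = FinSum ℚ.+-0-isCommutativeMonoid sumℚ (λ _ → refl) (λ _ → refl)
open ℚΣ using (listΣ)

sumℚ-scaleˡ : ∀ {n} c (f : Fin n → ℚ) → sumℚ (λ i → c * f i) ≡ c * sumℚ f
sumℚ-scaleˡ c f = begin
  sumℚ (λ i → c * f i)    ≡⟨ ℚΣ.Σ≡sum (λ i → c * f i) ⟩
  sum (λ i → c * f i)     ≡⟨ *-distribˡ-sum c f ⟨
  c * sum f               ≡⟨ cong (c *_) (ℚΣ.Σ≡sum f) ⟨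
  c * sumℚ f              ∎
  where
  open ≡-Reasoning
  open SemiringSum (CommutativeRing.semiring ℚ.+-*-commutativeRing) using (sum; *-distribˡ-sum)

sumℚ-scaleʳ : ∀ {n} c (f : Fin n → ℚ) → sumℚ (λ i → f i * c) ≡ sumℚ f * c
sumℚ-scaleʳ c f = begin
  sumℚ (λ i → f i * c) ≡⟨ ℚΣ.Σ-cong (λ i → ℚ.*-comm (f i) c) ⟩
  sumℚ (λ i → c * f i) ≡⟨ sumℚ-scaleˡ c f ⟩
  c * sumℚ f           ≡⟨ ℚ.*-comm c (sumℚ f) ⟩
  sumℚ f * c           ∎
  where open ≡-Reasoning

sumℚ-const : ∀ n c → sumℚ {n} (λ _ → c) ≡ ℕtoℚ n * c
sumℚ-const zero c = sym (ℚ.*-zeroˡ c)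
sumℚ-const (suc n) c = begin
  c + sumℚ {n} (λ _ → c)  ≡⟨ cong (c +_) (sumℚ-const n c) ⟩
  c + ℕtoℚ n * c          ≡⟨ cong (_+ ℕtoℚ n * c) (ℚ.*-identityˡ c) ⟨
  1ℚ * c + ℕtoℚ n * c     ≡⟨ ℚ.*-distribʳ-+ c 1ℚ (ℕtoℚ n) ⟨
  (1ℚ + ℕtoℚ n) * c       ≡⟨ cong (_* c) (ℕtoℚ-+ 1 n) ⟨
  ℕtoℚ (suc n) * c        ∎
  where open ≡-Reasoning

sumℚ-nearly-constant : ∀ {n} (w : Fin n → ℚ) W {ps} → Unique ps → (∀ e → e ∉ ps → w e ≡ W) →
  sumℚ w ≡ ℕtoℚ n * W + listΣ (λ e → w e - W) ps
sumℚ-nearly-constant {n} w W {ps} distinct constant = begin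
  sumℚ w                                  ≡⟨ ℚΣ.Σ-cong (λ e → split (w e)) ⟩
  sumℚ (λ e → W + (w e - W))              ≡⟨ ℚΣ.Σ-distrib (λ _ → W) (λ e → w e - W) ⟩
  sumℚ {n} (λ _ → W) + sumℚ (λ e → w e - W) ≡⟨ cong₂ _+_ (sumℚ-const n W) (ℚΣ.Σ-sparse _ distinct vanishes) ⟩
  ℕtoℚ n * W + listΣ (λ e → w e - W) ps   ∎
  where
  open ≡-Reasoning
  split : ∀ x → x ≡ W + (x - W)
  split x = solve (x ∷ W ∷ []) ℚ-ring
  vanishes : ∀ e → e ∉ ps → w e - W ≡ 0ℚ
  vanishes e e∉ps = trans (cong (_- W) (constant e e∉ps)) (ℚ.+-inverseʳ W)

listΣ-scaleˡ : ∀ {n} c (f : Fin n → ℚ) ks → listΣ (λ k → c * f k) ks ≡ c * listΣ f ks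
listΣ-scaleˡ c f [] = sym (ℚ.*-zeroʳ c)
listΣ-scaleˡ c f (k ∷ ks) = trans (cong (c * f k +_) (listΣ-scaleˡ c f ks)) (sym (ℚ.*-distribˡ-+ c (f k) _))

ℕtoℚ-sum : ∀ {n} (f : Fin n → ℕ) → ℕtoℚ (sumℕ f) ≡ sumℚ (ℕtoℚ ∘ f)
ℕtoℚ-sum {zero} f = refl
ℕtoℚ-sum {suc n} f = trans (ℕtoℚ-+ (f zero) _) (cong (ℕtoℚ (f zero) +_) (ℕtoℚ-sum (f ∘ suc)))

Symmetric : ∀ {n} → Graph n → Set
Symmetric G = ∀ x y → G x y ≡ G y x

record Neighbourhood {n} (G : Graph n) (x : Fin n) (ks : List (Fin n)) : Set where
  field
    adjacent : All (λ k → G x k ≡ true) ks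
    complete : ∀ k → G x k ≡ true → k ∈ ks
    distinct : Unique ks

  nonadjacent : ∀ k → k ∉ ks → G x k ≡ false
  nonadjacent k k∉ks with G x k in eq
  ... | true = ⊥-elim (k∉ks (complete k eq))
  ... | false = refl

P-adjacent : ∀ {n} (G : Graph n) {i k} → G i k ≡ true → P G i k ≡ invℕ (degree G i)
P-adjacent G {i} Gik rewrite Gik = ℚ.*-identityˡ (invℕ (degree G i))

P-nonadjacent : ∀ {n} (G : Graph n) {i k} → G i k ≡ false → P G i k ≡ 0ℚ
P-nonadjacent G {i} Gik rewrite Gik = ℚ.*-zeroˡ (invℕ (degree G i))

degree-neighbourhood : ∀ {n} {G : Graph n} {x ks} → Neighbourhood G x ks → degree G x ≡ length ks
degree-neighbourhood {G = G} {x} {ks} nbhd =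
  trans (ℕΣ.Σ-sparse (indicator ∘ G x) distinct (λ k k∉ks → cong indicator (nonadjacent k k∉ks)))
        (count adjacent)
  where
  open Neighbourhood nbhd
  count : ∀ {ks} → All (λ k → G x k ≡ true) ks → ℕΣ.listΣ (indicator ∘ G x) ks ≡ length ks
  count All.[] = refl
  count (Gxk All.∷ Gxks) rewrite Gxk = cong suc (count Gxks)

degree-adjacent : ∀ {n} (G : Graph n) {i k} → G i k ≡ true → ∃ λ d → degree G i ≡ suc d
degree-adjacent G {i} {k} Gik =
  _ , trans (ℕΣ.Σ-extract (indicator ∘ G i) k) (cong (λ a → indicator a ℕ.+ rest) Gik)
  where
  rest : ℕ
  rest = sumℕ (λ l → if ⌊ l ≟ k ⌋ then 0 else indicator (G i l))

step-neighbourhood : ∀ {n} {G : Graph n} {i ks} → Neighbourhood G i ks → ∀ (h : Fin n → ℚ) →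
  sumℚ (λ k → P G i k * h k) ≡ invℕ (length ks) * listΣ h ks
step-neighbourhood {G = G} {i} {ks} nbhd h = begin
  sumℚ (λ k → P G i k * h k)              ≡⟨ ℚΣ.Σ-sparse (λ k → P G i k * h k) distinct vanishes ⟩
  listΣ (λ k → P G i k * h k) ks          ≡⟨ ℚΣ.listΣ-cong (All.map uniform adjacent) ⟩
  listΣ (λ k → invℕ (length ks) * h k) ks ≡⟨ listΣ-scaleˡ (invℕ (length ks)) h ks ⟩
  invℕ (length ks) * listΣ h ks           ∎
  where
  open ≡-Reasoning
  open Neighbourhood nbhd
  vanishes : ∀ k → k ∉ ks → P G i k * h k ≡ 0ℚ
  vanishes k k∉ks = trans (cong (_* h k) (P-nonadjacent G (nonadjacent k k∉ks))) (ℚ.*-zeroˡ (h k))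
  uniform : ∀ {k} → G i k ≡ true → P G i k * h k ≡ invℕ (length ks) * h k
  uniform {k} Gik = cong (_* h k) (trans (P-adjacent G Gik) (cong invℕ (degree-neighbourhood nbhd)))

-- IsMFPT leaves m j j unconstrained; the hitting time of j from j itself is 0.
hit : ∀ {n} → (Fin n → Fin n → ℚ) → Fin n → Fin n → ℚ
hit m k j = if ⌊ k ≟ j ⌋ then 0ℚ else m k j

hit-diagonal : ∀ {n} (m : Fin n → Fin n → ℚ) j → hit m j j ≡ 0ℚ
hit-diagonal m j = cong (λ a → if a then 0ℚ else m j j) (⌊⌋-true (j ≟ j) refl)

hit-off-diagonal : ∀ {n} (m : Fin n → Fin n → ℚ) {k j} → k ≢ j → hit m k j ≡ m k j
hit-off-diagonal m {k} {j} k≢j = cong (λ a → if a then 0ℚ else m k j) (⌊⌋-false (k ≟ j) k≢j)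

first-step : ∀ {n} {G : Graph n} {m} → IsMFPT G m → ∀ {i j} → i ≢ j →
  m i j ≡ 1ℚ + sumℚ (λ k → P G i k * hit m k j)
first-step {G = G} {m} mfpt {i} {j} i≢j = trans (mfpt i j i≢j) (cong (1ℚ +_) (ℚΣ.Σ-cong excluded))
  where
  excluded : ∀ k → (if ⌊ k ≟ j ⌋ then 0ℚ else P G i k * m k j) ≡ P G i k * hit m k j
  excluded k with k ≟ j
  ... | yes _ = sym (ℚ.*-zeroʳ (P G i k))
  ... | no _ = refl

first-step-neighbourhood : ∀ {n} {G : Graph n} {m} → IsMFPT G m → ∀ {i j ks} → Neighbourhood G i ks → i ≢ j →
  hit m i j ≡ 1ℚ + invℕ (length ks) * listΣ (λ k → hit m k j) ks
first-step-neighbourhood {G = G} {m} mfpt {i} {j} nbhd i≢j =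
  trans (hit-off-diagonal m i≢j)
    (trans (first-step {G = G} mfpt i≢j) (cong (1ℚ +_) (step-neighbourhood nbhd (λ k → hit m k j))))

module RandomWalk {n} (G : Graph n) (symmetric : Symmetric G) {D-1 : ℕ} (total-degree : sumℕ (degree G) ≡ suc D-1) where

  D D⁻¹ : ℚ
  D = ℕtoℚ (suc D-1)
  D⁻¹ = invℕ (suc D-1)

  0≤D⁻¹ : 0ℚ ℚ.≤ D⁻¹
  0≤D⁻¹ = 0≤invℕ (suc D-1)

  D*D⁻¹ : D * D⁻¹ ≡ 1ℚ
  D*D⁻¹ = ℕtoℚ*invℕ D-1

  π≡degree*D⁻¹ : ∀ x → π G x ≡ ℕtoℚ (degree G x) * D⁻¹
  π≡degree*D⁻¹ x = cong (λ d → ℕtoℚ (degree G x) * invℕ d) total-degree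

  π-sum : sumℚ (π G) ≡ 1ℚ
  π-sum = begin
    sumℚ (π G)                                   ≡⟨ ℚΣ.Σ-cong (λ x → trans (π≡degree*D⁻¹ x) (ℚ.*-comm _ D⁻¹)) ⟩
    sumℚ (λ x → D⁻¹ * ℕtoℚ (degree G x))         ≡⟨ sumℚ-scaleˡ D⁻¹ (λ x → ℕtoℚ (degree G x)) ⟩
    D⁻¹ * sumℚ (λ x → ℕtoℚ (degree G x))         ≡⟨ cong (D⁻¹ *_) (ℕtoℚ-sum (degree G)) ⟨
    D⁻¹ * ℕtoℚ (sumℕ (degree G))                 ≡⟨ cong (λ d → D⁻¹ * ℕtoℚ d) total-degree ⟩
    D⁻¹ * D                                      ≡⟨ ℚ.*-comm D⁻¹ D ⟩
    D * D⁻¹                                      ≡⟨ D*D⁻¹ ⟩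
    1ℚ                                           ∎
    where open ≡-Reasoning

  π*P : ∀ i k → π G i * P G i k ≡ (if G k i then 1ℚ else 0ℚ) * D⁻¹
  π*P i k rewrite symmetric k i with G i k in Gik
  ... | false = trans (cong (π G i *_) (ℚ.*-zeroˡ (invℕ (degree G i)))) (trans (ℚ.*-zeroʳ (π G i)) (sym (ℚ.*-zeroˡ D⁻¹)))
  ... | true with degree-adjacent G Gik
  ...   | d , degree≡ = begin
    π G i * (1ℚ * invℕ (degree G i))              ≡⟨ cong₂ (λ p q → p * (1ℚ * q)) (π≡degree*D⁻¹ i) (cong invℕ degree≡) ⟩
    ℕtoℚ (degree G i) * D⁻¹ * (1ℚ * invℕ (suc d)) ≡⟨ cong (λ e → ℕtoℚ e * D⁻¹ * (1ℚ * invℕ (suc d))) degree≡ ⟩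
    ℕtoℚ (suc d) * D⁻¹ * (1ℚ * invℕ (suc d))      ≡⟨ rearrange (ℕtoℚ (suc d)) D⁻¹ (invℕ (suc d)) ⟩
    ℕtoℚ (suc d) * invℕ (suc d) * D⁻¹             ≡⟨ cong (_* D⁻¹) (ℕtoℚ*invℕ d) ⟩
    1ℚ * D⁻¹                                      ∎
    where
    open ≡-Reasoning
    rearrange : ∀ a b c → a * b * (1ℚ * c) ≡ a * c * b
    rearrange a b c = solve (a ∷ b ∷ c ∷ []) ℚ-ring

  stationary : ∀ k → sumℚ (λ i → π G i * P G i k) ≡ π G k
  stationary k = begin
    sumℚ (λ i → π G i * P G i k)                    ≡⟨ ℚΣ.Σ-cong (λ i → trans (π*P i k) (ℚ.*-comm _ D⁻¹)) ⟩
    sumℚ (λ i → D⁻¹ * (if G k i then 1ℚ else 0ℚ))   ≡⟨ sumℚ-scaleˡ D⁻¹ (λ i → if G k i then 1ℚ else 0ℚ) ⟩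
    D⁻¹ * sumℚ (λ i → if G k i then 1ℚ else 0ℚ)     ≡⟨ cong (D⁻¹ *_) (ℚΣ.Σ-cong (λ i → ℕtoℚ-indicator (G k i))) ⟨
    D⁻¹ * sumℚ (λ i → ℕtoℚ (indicator (G k i)))      ≡⟨ cong (D⁻¹ *_) (ℕtoℚ-sum (indicator ∘ G k)) ⟨
    D⁻¹ * ℕtoℚ (degree G k)                          ≡⟨ ℚ.*-comm D⁻¹ _ ⟩
    ℕtoℚ (degree G k) * D⁻¹                          ≡⟨ π≡degree*D⁻¹ k ⟨
    π G k                                            ∎
    where
    open ≡-Reasoning
    ℕtoℚ-indicator : ∀ a → ℕtoℚ (indicator a) ≡ (if a then 1ℚ else 0ℚ)
    ℕtoℚ-indicator true = refl
    ℕtoℚ-indicator false = refl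

  -- Kac's formula (the mean return time to j is 1/π_j), obtained by averaging the
  -- first-step equations against the stationary distribution.
  kac : ∀ {m} → IsMFPT G m → ∀ j → π G j * sumℚ (λ k → P G j k * hit m k j) ≡ 1ℚ - π G j
  kac {m} mfpt j =
    kac-algebra (π G j * S j) (π G j) (sumℚ πS) (sumℚ (λ i → π G i * hit m i j)) (off-j (π G)) (off-j πS)
      split-hit average-of-steps (ℚΣ.Σ-extract πS j) (trans (sym π-sum) (ℚΣ.Σ-extract (π G) j))
    where
    open ≡-Reasoning
    S : Fin n → ℚ
    S i = sumℚ (λ k → P G i k * hit m k j)
    πS : Fin n → ℚ
    πS i = π G i * S i
    off-j : (Fin n → ℚ) → ℚ
    off-j g = sumℚ (λ i → if ⌊ i ≟ j ⌋ then 0ℚ else g i)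

    kac-algebra : ∀ (T p X Y E₁ E₂ : ℚ) → Y ≡ E₁ + E₂ → X ≡ Y → X ≡ T + E₂ → 1ℚ ≡ p + E₁ →
      T ≡ 1ℚ - p
    kac-algebra T p X Y E₁ E₂ h₁ h₂ h₃ h₄ =
      linear-combination (h₁ ⊕ h₂ ⊕ -1 ⋆ h₃ ⊕ -1 ⋆ h₄) (solve (T ∷ p ∷ X ∷ Y ∷ E₁ ∷ E₂ ∷ []) ℚ-ring)

    split-hit : sumℚ (λ i → π G i * hit m i j) ≡ off-j (π G) + off-j πS
    split-hit = trans (ℚΣ.Σ-cong pointwise)
      (ℚΣ.Σ-distrib (λ i → if ⌊ i ≟ j ⌋ then 0ℚ else π G i) (λ i → if ⌊ i ≟ j ⌋ then 0ℚ else πS i))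
      where
      pointwise : ∀ i → π G i * hit m i j ≡ (if ⌊ i ≟ j ⌋ then 0ℚ else π G i) + (if ⌊ i ≟ j ⌋ then 0ℚ else πS i)
      pointwise i with i ≟ j
      ... | yes _ = ℚ.*-zeroʳ (π G i)
      ... | no i≢j = begin
        π G i * m i j           ≡⟨ cong (π G i *_) (first-step {G = G} mfpt i≢j) ⟩
        π G i * (1ℚ + S i)      ≡⟨ ℚ.*-distribˡ-+ (π G i) 1ℚ (S i) ⟩
        π G i * 1ℚ + π G i * S i ≡⟨ cong (_+ πS i) (ℚ.*-identityʳ (π G i)) ⟩
        π G i + πS i            ∎

    average-of-steps : sumℚ πS ≡ sumℚ (λ k → π G k * hit m k j)
    average-of-steps = begin
      sumℚ (λ i → π G i * sumℚ (λ k → P G i k * hit m k j))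
        ≡⟨ ℚΣ.Σ-cong (λ i → sym (sumℚ-scaleˡ (π G i) (λ k → P G i k * hit m k j))) ⟩
      sumℚ (λ i → sumℚ (λ k → π G i * (P G i k * hit m k j)))
        ≡⟨ ℚΣ.Σ-comm (λ i k → π G i * (P G i k * hit m k j)) ⟩
      sumℚ (λ k → sumℚ (λ i → π G i * (P G i k * hit m k j)))
        ≡⟨ ℚΣ.Σ-cong (λ k → ℚΣ.Σ-cong (λ i → sym (ℚ.*-assoc (π G i) (P G i k) (hit m k j)))) ⟩
      sumℚ (λ k → sumℚ (λ i → π G i * P G i k * hit m k j))
        ≡⟨ ℚΣ.Σ-cong (λ k → sumℚ-scaleʳ (hit m k j) (λ i → π G i * P G i k)) ⟩
      sumℚ (λ k → sumℚ (λ i → π G i * P G i k) * hit m k j)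
        ≡⟨ ℚΣ.Σ-cong (λ k → cong (_* hit m k j) (stationary k)) ⟩
      sumℚ (λ k → π G k * hit m k j) ∎

  kac-neighbourhood : ∀ {m} → IsMFPT G m → ∀ {j k ks} → Neighbourhood G j (k ∷ ks) →
    listΣ (λ l → hit m l j) (k ∷ ks) ≡ D - ℕtoℚ (length (k ∷ ks))
  kac-neighbourhood {m} mfpt {j} {k} {ks} nbhd =
    kac-local-algebra (ℕtoℚ d) (invℕ d) D D⁻¹ (listΣ (λ l → hit m l j) (k ∷ ks))
      local-kac (ℕtoℚ*invℕ (length ks)) D*D⁻¹
    where
    d : ℕ
    d = length (k ∷ ks)
    kac-local-algebra : ∀ (d d⁻¹ D D⁻¹ L : ℚ) → d * D⁻¹ * (d⁻¹ * L) ≡ 1ℚ - d * D⁻¹ → d * d⁻¹ ≡ 1ℚ →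
      D * D⁻¹ ≡ 1ℚ → L ≡ D - d
    kac-local-algebra d d⁻¹ D D⁻¹ L h₁ h₂ h₃ =
      linear-combination (D ⋆ h₁ ⊕ -1 * L * D * D⁻¹ ⋆ h₂ ⊕ -1 * (L + d) ⋆ h₃)
        (solve (d ∷ d⁻¹ ∷ D ∷ D⁻¹ ∷ L ∷ []) ℚ-ring)
    π-j : π G j ≡ ℕtoℚ d * D⁻¹
    π-j = trans (π≡degree*D⁻¹ j) (cong (λ e → ℕtoℚ e * D⁻¹) (degree-neighbourhood nbhd))
    local-kac : ℕtoℚ d * D⁻¹ * (invℕ d * listΣ (λ l → hit m l j) (k ∷ ks)) ≡ 1ℚ - ℕtoℚ d * D⁻¹
    local-kac = subst (λ p → p * (invℕ d * listΣ (λ l → hit m l j) (k ∷ ks)) ≡ 1ℚ - p) π-j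
      (subst (λ s → π G j * s ≡ 1ℚ - π G j) (step-neighbourhood nbhd (λ l → hit m l j)) (kac mfpt j))

-- The hypotheses of each local solver have exactly the shape produced by first-step-neighbourhood
-- and kac-neighbourhood on explicit neighbour lists (hence the trailing + 0ℚ).
module Configurations {n} (G : Graph n) (symmetric : Symmetric G) {D-1 : ℕ} (total-degree : sumℕ (degree G) ≡ suc D-1)
  (loopless : ∀ x → G x x ≡ false) {m} (mfpt : IsMFPT G m) where
  open RandomWalk G symmetric total-degree

  private
    neighbour≢ : ∀ {i j ks} → Neighbourhood G i ks → j ∈ ks → i ≢ j
    neighbour≢ {i} nbhd j∈ks refl with trans (sym (loopless i)) (All.lookup (Neighbourhood.adjacent nbhd) j∈ks)
    ... | ()

  pendant-path : ∀ {c x y} → Neighbourhood G x (c ∷ y ∷ []) → Neighbourhood G y (x ∷ []) →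
    hit m c x ≡ D - 3 × hit m c y ≡ 2 * D - 4
  pendant-path {c} {x} {y} nx ny =
    solve-x D (hit m c x) (hit m y x) (hit m x x)
      (hit-diagonal m x) (first-step-neighbourhood mfpt ny (neighbour≢ ny (here refl))) (kac-neighbourhood mfpt nx) ,
    solve-y D (hit m c y) (hit m x y) (hit m y y)
      (hit-diagonal m y) (first-step-neighbourhood mfpt nx (neighbour≢ nx (there (here refl)))) (kac-neighbourhood mfpt ny)
    where
    solve-x : ∀ D hcx hyx hxx → hxx ≡ 0ℚ → hyx ≡ 1ℚ + 1 / 1 * (hxx + 0ℚ) → hcx + (hyx + 0ℚ) ≡ D - 2 →
      hcx ≡ D - 3
    solve-x D hcx hyx hxx h₁ h₂ h₃ =
      linear-combination (-1 ⋆ h₁ ⊕ -1 ⋆ h₂ ⊕ 1 ⋆ h₃) (solve (D ∷ hcx ∷ hyx ∷ hxx ∷ []) ℚ-ring)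
    solve-y : ∀ D hcy hxy hyy → hyy ≡ 0ℚ → hxy ≡ 1ℚ + 1 / 2 * (hcy + (hyy + 0ℚ)) → hxy + 0ℚ ≡ D - 1 →
      hcy ≡ 2 * D - 4
    solve-y D hcy hxy hyy h₁ h₂ h₃ =
      linear-combination (-1 ⋆ h₁ ⊕ -2 ⋆ h₂ ⊕ 2 ⋆ h₃) (solve (D ∷ hcy ∷ hxy ∷ hyy ∷ []) ℚ-ring)

  triangle : ∀ {c x y} → Neighbourhood G x (c ∷ y ∷ []) → Neighbourhood G y (c ∷ x ∷ []) →
    hit m c x ≡ 2 / 3 * D - 2
  triangle {c} {x} {y} nx ny =
    solve-x D (hit m c x) (hit m y x) (hit m x x)
      (hit-diagonal m x) (first-step-neighbourhood mfpt ny (neighbour≢ ny (there (here refl)))) (kac-neighbourhood mfpt nx)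
    where
    solve-x : ∀ D hcx hyx hxx → hxx ≡ 0ℚ → hyx ≡ 1ℚ + 1 / 2 * (hcx + (hxx + 0ℚ)) → hcx + (hyx + 0ℚ) ≡ D - 2 →
      hcx ≡ 2 / 3 * D - 2
    solve-x D hcx hyx hxx h₁ h₂ h₃ =
      linear-combination (-1 / 3 ⋆ h₁ ⊕ -2 / 3 ⋆ h₂ ⊕ 2 / 3 ⋆ h₃) (solve (D ∷ hcx ∷ hyx ∷ hxx ∷ []) ℚ-ring)

  bridged-legs : ∀ {c x y x′ y′} → Neighbourhood G x (x′ ∷ c ∷ y ∷ []) → Neighbourhood G y (x ∷ []) →
    Neighbourhood G x′ (x ∷ c ∷ y′ ∷ []) → Neighbourhood G y′ (x′ ∷ []) → x ≢ y′ → y ≢ x′ → y ≢ y′ →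
    hit m c x ≡ 2 / 3 * D - 4 × hit m c y ≡ 5 / 3 * D - 5
  bridged-legs {c} {x} {y} {x′} {y′} nx ny nx′ ny′ x≢y′ y≢x′ y≢y′ =
    solve-x D (hit m c x) (hit m x x) (hit m y x) (hit m x′ x) (hit m y′ x)
      (hit-diagonal m x) (first-step-neighbourhood mfpt ny (neighbour≢ ny (here refl)))
      (first-step-neighbourhood mfpt nx′ (neighbour≢ nx′ (here refl)))
      (first-step-neighbourhood mfpt ny′ (≢-sym x≢y′)) (kac-neighbourhood mfpt nx) ,
    solve-y D (hit m c y) (hit m y y) (hit m x y) (hit m x′ y) (hit m y′ y)
      (hit-diagonal m y) (first-step-neighbourhood mfpt nx (neighbour≢ nx (there (there (here refl)))))
      (first-step-neighbourhood mfpt nx′ (≢-sym y≢x′)) (first-step-neighbourhood mfpt ny′ (≢-sym y≢y′))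
      (kac-neighbourhood mfpt ny)
    where
    solve-x : ∀ D hcx hxx hyx hx′x hy′x → hxx ≡ 0ℚ → hyx ≡ 1ℚ + 1 / 1 * (hxx + 0ℚ) →
      hx′x ≡ 1ℚ + 1 / 3 * (hxx + (hcx + (hy′x + 0ℚ))) → hy′x ≡ 1ℚ + 1 / 1 * (hx′x + 0ℚ) →
      hx′x + (hcx + (hyx + 0ℚ)) ≡ D - 3 → hcx ≡ 2 / 3 * D - 4
    solve-x D hcx hxx hyx hx′x hy′x h₁ h₂ h₃ h₄ h₅ =
      linear-combination (-1 ⋆ h₁ ⊕ -2 / 3 ⋆ h₂ ⊕ -1 ⋆ h₃ ⊕ -1 / 3 ⋆ h₄ ⊕ 2 / 3 ⋆ h₅)
        (solve (D ∷ hcx ∷ hxx ∷ hyx ∷ hx′x ∷ hy′x ∷ []) ℚ-ring)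
    solve-y : ∀ D hcy hyy hxy hx′y hy′y → hyy ≡ 0ℚ → hxy ≡ 1ℚ + 1 / 3 * (hx′y + (hcy + (hyy + 0ℚ))) →
      hx′y ≡ 1ℚ + 1 / 3 * (hxy + (hcy + (hy′y + 0ℚ))) → hy′y ≡ 1ℚ + 1 / 1 * (hx′y + 0ℚ) →
      hxy + 0ℚ ≡ D - 1 → hcy ≡ 5 / 3 * D - 5
    solve-y D hcy hyy hxy hx′y hy′y h₁ h₂ h₃ h₄ h₅ =
      linear-combination (-2 / 3 ⋆ h₁ ⊕ -2 ⋆ h₂ ⊕ -1 ⋆ h₃ ⊕ -1 / 3 ⋆ h₄ ⊕ 5 / 3 ⋆ h₅)
        (solve (D ∷ hcy ∷ hyy ∷ hxy ∷ hx′y ∷ hy′y ∷ []) ℚ-ring)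

  mid-to-leaf : ∀ {c x y x′ y′} → Neighbourhood G x (y′ ∷ c ∷ y ∷ []) → Neighbourhood G y (x ∷ []) →
    Neighbourhood G y′ (x ∷ x′ ∷ []) → Neighbourhood G x′ (c ∷ y′ ∷ []) → x ≢ x′ → y ≢ y′ → y ≢ x′ →
    (hit m c x ≡ 3 / 4 * D - 9 / 2 × hit m c y ≡ 7 / 4 * D - 11 / 2) ×
    (hit m c x′ ≡ 3 / 4 * D - 7 / 2 × hit m c y′ ≡ D - 5)
  mid-to-leaf {c} {x} {y} {x′} {y′} nx ny ny′ nx′ x≢x′ y≢y′ y≢x′ =
    (solve-x D (hit m c x) (hit m x x) (hit m y x) (hit m y′ x) (hit m x′ x)
       (hit-diagonal m x) (first-step-neighbourhood mfpt ny (neighbour≢ ny (here refl)))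
       (first-step-neighbourhood mfpt ny′ (neighbour≢ ny′ (here refl)))
       (first-step-neighbourhood mfpt nx′ (≢-sym x≢x′)) (kac-neighbourhood mfpt nx) ,
     solve-y D (hit m c y) (hit m y y) (hit m x y) (hit m y′ y) (hit m x′ y)
       (hit-diagonal m y) (first-step-neighbourhood mfpt nx (neighbour≢ nx (there (there (here refl)))))
       (first-step-neighbourhood mfpt ny′ (≢-sym y≢y′)) (first-step-neighbourhood mfpt nx′ (≢-sym y≢x′))
       (kac-neighbourhood mfpt ny)) ,
    (solve-x′ D (hit m c x′) (hit m x′ x′) (hit m y′ x′) (hit m x x′) (hit m y x′)
       (hit-diagonal m x′) (first-step-neighbourhood mfpt ny′ (neighbour≢ ny′ (there (here refl))))
       (first-step-neighbourhood mfpt nx x≢x′) (first-step-neighbourhood mfpt ny y≢x′)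
       (kac-neighbourhood mfpt nx′) ,
     solve-y′ D (hit m c y′) (hit m y′ y′) (hit m x y′) (hit m y y′) (hit m x′ y′)
       (hit-diagonal m y′) (first-step-neighbourhood mfpt nx (neighbour≢ nx (here refl)))
       (first-step-neighbourhood mfpt ny y≢y′) (first-step-neighbourhood mfpt nx′ (neighbour≢ nx′ (there (here refl))))
       (kac-neighbourhood mfpt ny′))
    where
    solve-x : ∀ D hcx hxx hyx hy′x hx′x → hxx ≡ 0ℚ → hyx ≡ 1ℚ + 1 / 1 * (hxx + 0ℚ) →
      hy′x ≡ 1ℚ + 1 / 2 * (hxx + (hx′x + 0ℚ)) → hx′x ≡ 1ℚ + 1 / 2 * (hcx + (hy′x + 0ℚ)) →
      hy′x + (hcx + (hyx + 0ℚ)) ≡ D - 3 → hcx ≡ 3 / 4 * D - 9 / 2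
    solve-x D hcx hxx hyx hy′x hx′x h₁ h₂ h₃ h₄ h₅ =
      linear-combination (-5 / 4 ⋆ h₁ ⊕ -3 / 4 ⋆ h₂ ⊕ -1 ⋆ h₃ ⊕ -1 / 2 ⋆ h₄ ⊕ 3 / 4 ⋆ h₅)
        (solve (D ∷ hcx ∷ hxx ∷ hyx ∷ hy′x ∷ hx′x ∷ []) ℚ-ring)
    solve-y : ∀ D hcy hyy hxy hy′y hx′y → hyy ≡ 0ℚ → hxy ≡ 1ℚ + 1 / 3 * (hy′y + (hcy + (hyy + 0ℚ))) →
      hy′y ≡ 1ℚ + 1 / 2 * (hxy + (hx′y + 0ℚ)) → hx′y ≡ 1ℚ + 1 / 2 * (hcy + (hy′y + 0ℚ)) →
      hxy + 0ℚ ≡ D - 1 → hcy ≡ 7 / 4 * D - 11 / 2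
    solve-y D hcy hyy hxy hy′y hx′y h₁ h₂ h₃ h₄ h₅ =
      linear-combination (-3 / 4 ⋆ h₁ ⊕ -9 / 4 ⋆ h₂ ⊕ -1 ⋆ h₃ ⊕ -1 / 2 ⋆ h₄ ⊕ 7 / 4 ⋆ h₅)
        (solve (D ∷ hcy ∷ hyy ∷ hxy ∷ hy′y ∷ hx′y ∷ []) ℚ-ring)
    solve-x′ : ∀ D hcx′ hx′x′ hy′x′ hxx′ hyx′ → hx′x′ ≡ 0ℚ →
      hy′x′ ≡ 1ℚ + 1 / 2 * (hxx′ + (hx′x′ + 0ℚ)) →
      hxx′ ≡ 1ℚ + 1 / 3 * (hy′x′ + (hcx′ + (hyx′ + 0ℚ))) → hyx′ ≡ 1ℚ + 1 / 1 * (hxx′ + 0ℚ) →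
      hcx′ + (hy′x′ + 0ℚ) ≡ D - 2 → hcx′ ≡ 3 / 4 * D - 7 / 2
    solve-x′ D hcx′ hx′x′ hy′x′ hxx′ hyx′ h₁ h₂ h₃ h₄ h₅ =
      linear-combination (-1 / 2 ⋆ h₁ ⊕ -1 ⋆ h₂ ⊕ -3 / 4 ⋆ h₃ ⊕ -1 / 4 ⋆ h₄ ⊕ 3 / 4 ⋆ h₅)
        (solve (D ∷ hcx′ ∷ hx′x′ ∷ hy′x′ ∷ hxx′ ∷ hyx′ ∷ []) ℚ-ring)
    solve-y′ : ∀ D hcy′ hy′y′ hxy′ hyy′ hx′y′ → hy′y′ ≡ 0ℚ →
      hxy′ ≡ 1ℚ + 1 / 3 * (hy′y′ + (hcy′ + (hyy′ + 0ℚ))) →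
      hyy′ ≡ 1ℚ + 1 / 1 * (hxy′ + 0ℚ) → hx′y′ ≡ 1ℚ + 1 / 2 * (hcy′ + (hy′y′ + 0ℚ)) →
      hxy′ + (hx′y′ + 0ℚ) ≡ D - 2 → hcy′ ≡ D - 5
    solve-y′ D hcy′ hy′y′ hxy′ hyy′ hx′y′ h₁ h₂ h₃ h₄ h₅ =
      linear-combination (-1 ⋆ h₁ ⊕ -3 / 2 ⋆ h₂ ⊕ -1 / 2 ⋆ h₃ ⊕ -1 ⋆ h₄ ⊕ 1 ⋆ h₅)
        (solve (D ∷ hcy′ ∷ hy′y′ ∷ hxy′ ∷ hyy′ ∷ hx′y′ ∷ []) ℚ-ring)

  pentagon : ∀ {c x y x′ y′} → Neighbourhood G x (c ∷ y ∷ []) → Neighbourhood G y (y′ ∷ x ∷ []) →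
    Neighbourhood G y′ (y ∷ x′ ∷ []) → Neighbourhood G x′ (c ∷ y′ ∷ []) → x ≢ y′ → x ≢ x′ → y ≢ x′ →
    hit m c x ≡ 4 / 5 * D - 4 × hit m c y ≡ 6 / 5 * D - 6
  pentagon {c} {x} {y} {x′} {y′} nx ny ny′ nx′ x≢y′ x≢x′ y≢x′ =
    solve-x D (hit m c x) (hit m x x) (hit m y x) (hit m y′ x) (hit m x′ x)
      (hit-diagonal m x) (first-step-neighbourhood mfpt ny (neighbour≢ ny (there (here refl))))
      (first-step-neighbourhood mfpt ny′ (≢-sym x≢y′)) (first-step-neighbourhood mfpt nx′ (≢-sym x≢x′))
      (kac-neighbourhood mfpt nx) ,
    solve-y D (hit m c y) (hit m y y) (hit m x y) (hit m y′ y) (hit m x′ y)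
      (hit-diagonal m y) (first-step-neighbourhood mfpt nx (neighbour≢ nx (there (here refl))))
      (first-step-neighbourhood mfpt ny′ (neighbour≢ ny′ (here refl))) (first-step-neighbourhood mfpt nx′ (≢-sym y≢x′))
      (kac-neighbourhood mfpt ny)
    where
    solve-x : ∀ D hcx hxx hyx hy′x hx′x → hxx ≡ 0ℚ → hyx ≡ 1ℚ + 1 / 2 * (hy′x + (hxx + 0ℚ)) →
      hy′x ≡ 1ℚ + 1 / 2 * (hyx + (hx′x + 0ℚ)) → hx′x ≡ 1ℚ + 1 / 2 * (hcx + (hy′x + 0ℚ)) →
      hcx + (hyx + 0ℚ) ≡ D - 2 → hcx ≡ 4 / 5 * D - 4
    solve-x D hcx hxx hyx hy′x hx′x h₁ h₂ h₃ h₄ h₅ =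
      linear-combination (-3 / 5 ⋆ h₁ ⊕ -6 / 5 ⋆ h₂ ⊕ -4 / 5 ⋆ h₃ ⊕ -2 / 5 ⋆ h₄ ⊕ 4 / 5 ⋆ h₅)
        (solve (D ∷ hcx ∷ hxx ∷ hyx ∷ hy′x ∷ hx′x ∷ []) ℚ-ring)
    solve-y : ∀ D hcy hyy hxy hy′y hx′y → hyy ≡ 0ℚ → hxy ≡ 1ℚ + 1 / 2 * (hcy + (hyy + 0ℚ)) →
      hy′y ≡ 1ℚ + 1 / 2 * (hyy + (hx′y + 0ℚ)) → hx′y ≡ 1ℚ + 1 / 2 * (hcy + (hy′y + 0ℚ)) →
      hy′y + (hxy + 0ℚ) ≡ D - 2 → hcy ≡ 6 / 5 * D - 6
    solve-y D hcy hyy hxy hy′y hx′y h₁ h₂ h₃ h₄ h₅ =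
      linear-combination (-7 / 5 ⋆ h₁ ⊕ -6 / 5 ⋆ h₂ ⊕ -8 / 5 ⋆ h₃ ⊕ -4 / 5 ⋆ h₄ ⊕ 6 / 5 ⋆ h₅)
        (solve (D ∷ hcy ∷ hyy ∷ hxy ∷ hy′y ∷ hx′y ∷ []) ℚ-ring)

Neighbourhood-cong : ∀ {n} {G H : Graph n} {x ks} → (∀ y → G x y ≡ H x y) → Neighbourhood G x ks → Neighbourhood H x ks
Neighbourhood-cong G≗H nbhd = record
  { adjacent = All.map (λ {k} Gxk → trans (sym (G≗H k)) Gxk) adjacent
  ; complete = λ k Hxk → complete k (trans (G≗H k) Hxk)
  ; distinct = distinct
  }
  where open Neighbourhood nbhd

IsKemeny-cong : ∀ {n} {G H : Graph n} → (∀ x y → G x y ≡ H x y) → ∀ {κ} → IsKemeny G κ → IsKemeny H κ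
IsKemeny-cong {G = G} {H} G≗H {κ} (m , mfpt , rows) = m , mfpt′ , rows′
  where
  degree≡ : ∀ x → degree G x ≡ degree H x
  degree≡ x = ℕΣ.Σ-cong (λ k → cong indicator (G≗H x k))
  P≡ : ∀ i k → P G i k ≡ P H i k
  P≡ i k = cong₂ (λ a d → (if a then 1ℚ else 0ℚ) ℚ.* invℕ d) (G≗H i k) (degree≡ i)
  π≡ : ∀ j → π G j ≡ π H j
  π≡ j = cong₂ (λ d D → ℕtoℚ d ℚ.* invℕ D) (degree≡ j) (ℕΣ.Σ-cong degree≡)
  mfpt′ : IsMFPT H m
  mfpt′ i j i≢j = trans (mfpt i j i≢j) (cong (λ s → 1ℚ ℚ.+ s)
    (ℚΣ.Σ-cong (λ k → cong (λ p → if ⌊ k ≟ j ⌋ then 0ℚ else p ℚ.* m k j) (P≡ i k))))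
  rows′ : ∀ i → sumℚ-except i (λ j → m i j ℚ.* π H j) ≡ κ
  rows′ i = trans (ℚΣ.Σ-cong (λ j → cong (λ p → if ⌊ j ≟ i ⌋ then 0ℚ else m i j ℚ.* p) (sym (π≡ j)))) (rows i)

addEdge-comm : ∀ {n} (G : Graph n) u v x y → addEdge G u v x y ≡ addEdge G v u x y
addEdge-comm G u v x y = cong (G x y ∨_) (∨-comm (⌊ x ≟ u ⌋ ∧ ⌊ y ≟ v ⌋) _)

IsBraess-sym : ∀ {n} {G : Graph n} → Symmetric G → ∀ {u v} → IsBraess G u v → IsBraess G v u
IsBraess-sym {G = G} symmetric {u} {v} (u≢v , Guv≡false , κ , κ′ , kemeny , kemeny′ , κ<κ′) =
  ≢-sym u≢v , trans (symmetric v u) Guv≡false , κ , κ′ , kemeny , IsKemeny-cong (addEdge-comm G u v) kemeny′ , κ<κ′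

point-sum : ∀ {n} (a : Fin n) → sumℕ (λ k → indicator ⌊ k ≟ a ⌋) ≡ 1
point-sum a = trans (ℕΣ.Σ-extract (λ k → indicator ⌊ k ≟ a ⌋) a)
  (cong₂ ℕ._+_ (cong indicator (⌊⌋-true (a ≟ a) refl)) (ℕΣ.Σ-zero vanishes))
  where
  vanishes : ∀ k → (if ⌊ k ≟ a ⌋ then 0 else indicator ⌊ k ≟ a ⌋) ≡ 0
  vanishes k with k ≟ a
  ... | yes _ = refl
  ... | no _ = refl

indicator-∨ : ∀ {a b} → (b ≡ true → a ≡ false) → indicator (a ∨ b) ≡ indicator a ℕ.+ indicator b
indicator-∨ {true} {true} disjoint with disjoint refl
... | ()
indicator-∨ {true} {false} _ = refl
indicator-∨ {false} _ = refl

degree-extend : ∀ {n} {G H : Graph n} {x w} → G x w ≡ false → (∀ y → H x y ≡ G x y ∨ ⌊ y ≟ w ⌋) →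
  degree H x ≡ degree G x ℕ.+ 1
degree-extend {n} {G = G} {H} {x} {w} Gxw≡false H≡ = begin
  degree H x                                                   ≡⟨ ℕΣ.Σ-cong (λ y → cong indicator (H≡ y)) ⟩
  sumℕ (λ y → indicator (G x y ∨ ⌊ y ≟ w ⌋))                    ≡⟨ ℕΣ.Σ-cong (λ y → indicator-∨ (new y)) ⟩
  sumℕ (λ y → indicator (G x y) ℕ.+ indicator ⌊ y ≟ w ⌋)         ≡⟨ ℕΣ.Σ-distrib {n} _ _ ⟩
  degree G x ℕ.+ sumℕ (λ y → indicator ⌊ y ≟ w ⌋)               ≡⟨ cong (degree G x ℕ.+_) (point-sum w) ⟩
  degree G x ℕ.+ 1                                              ∎
  where
  open ≡-Reasoning
  new : ∀ y → ⌊ y ≟ w ⌋ ≡ true → G x y ≡ false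
  new y y≟w with y ≟ w
  ... | yes refl = Gxw≡false

module _ {n} (G : Graph n) {u v : Fin n} (u≢v : u ≢ v) (Guv≡false : G u v ≡ false) where

  addEdge-elsewhere : ∀ {x} → x ≢ u → x ≢ v → ∀ y → addEdge G u v x y ≡ G x y
  addEdge-elsewhere {x} x≢u x≢v y with x ≟ u | x ≟ v
  ... | yes x≡u | _ = ⊥-elim (x≢u x≡u)
  ... | no _ | yes x≡v = ⊥-elim (x≢v x≡v)
  ... | no _ | no _ = ∨-identityʳ (G x y)

  addEdge-source : ∀ y → addEdge G u v u y ≡ G u y ∨ ⌊ y ≟ v ⌋
  addEdge-source y with u ≟ u | u ≟ v
  ... | no u≢u | _ = ⊥-elim (u≢u refl)
  ... | yes _ | yes u≡v = ⊥-elim (u≢v u≡v)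
  ... | yes _ | no _ = cong (G u y ∨_) (∨-identityʳ _)

  neighbourhood-addEdge-elsewhere : ∀ {x ks} → x ≢ u → x ≢ v → Neighbourhood G x ks → Neighbourhood (addEdge G u v) x ks
  neighbourhood-addEdge-elsewhere x≢u x≢v = Neighbourhood-cong (λ y → sym (addEdge-elsewhere x≢u x≢v y))

  neighbourhood-addEdge-source : ∀ {ks} → Neighbourhood G u ks → Neighbourhood (addEdge G u v) u (v ∷ ks)
  neighbourhood-addEdge-source {ks} nbhd = record
    { adjacent = trans (addEdge-source v) (trans (cong (G u v ∨_) (⌊⌋-true (v ≟ v) refl)) (∨-zeroʳ _))
                 All.∷ All.map (λ {k} Guk → trans (addEdge-source k) (cong (_∨ ⌊ k ≟ v ⌋) Guk)) adjacent
    ; complete = λ k G′uk → new-or-old k (trans (sym (addEdge-source k)) G′uk)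
    ; distinct = All.map (λ {k} Guk v≡k → true≢false (trans (sym Guk) (trans (cong (G u) (sym v≡k)) Guv≡false))) adjacent
                 AllPairs.∷ distinct
    }
    where
    open Neighbourhood nbhd
    true≢false : true ≢ false
    true≢false ()
    new-or-old : ∀ k → G u k ∨ ⌊ k ≟ v ⌋ ≡ true → k ∈ v ∷ ks
    new-or-old k eq with G u k in Guk | k ≟ v
    ... | true | _ = there (complete k Guk)
    ... | false | yes k≡v = here k≡v

  addEdge-target : ∀ y → addEdge G u v v y ≡ G v y ∨ ⌊ y ≟ u ⌋
  addEdge-target y with v ≟ u | v ≟ v
  ... | yes v≡u | _ = ⊥-elim (u≢v (sym v≡u))
  ... | no _ | no v≢v = ⊥-elim (v≢v refl)
  ... | no _ | yes _ = refl

  degree-addEdge : Symmetric G → ∀ x →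
    degree (addEdge G u v) x ≡ degree G x ℕ.+ indicator ⌊ x ≟ u ⌋ ℕ.+ indicator ⌊ x ≟ v ⌋
  degree-addEdge symmetric x = by-cases (x ≟ u) (x ≟ v)
    where
    Formula : Fin n → Set
    Formula y = degree (addEdge G u v) y ≡ degree G y ℕ.+ indicator ⌊ y ≟ u ⌋ ℕ.+ indicator ⌊ y ≟ v ⌋
    at-source : Formula u
    at-source = begin
      degree (addEdge G u v) u ≡⟨ degree-extend {G = G} {H = addEdge G u v} Guv≡false addEdge-source ⟩
      degree G u ℕ.+ 1       ≡⟨ ℕ.+-identityʳ _ ⟨
      degree G u ℕ.+ 1 ℕ.+ 0 ≡⟨ cong₂ (λ a c → degree G u ℕ.+ indicator a ℕ.+ indicator c) (⌊⌋-true (u ≟ u) refl) (⌊⌋-false (u ≟ v) u≢v) ⟨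
      degree G u ℕ.+ indicator ⌊ u ≟ u ⌋ ℕ.+ indicator ⌊ u ≟ v ⌋ ∎
      where open ≡-Reasoning
    at-target : Formula v
    at-target = begin
      degree (addEdge G u v) v ≡⟨ degree-extend {G = G} {H = addEdge G u v} Gvu≡false addEdge-target ⟩
      degree G v ℕ.+ 1       ≡⟨ cong (ℕ._+ 1) (ℕ.+-identityʳ _) ⟨
      degree G v ℕ.+ 0 ℕ.+ 1
        ≡⟨ cong₂ (λ a c → degree G v ℕ.+ indicator a ℕ.+ indicator c) (⌊⌋-false (v ≟ u) (≢-sym u≢v)) (⌊⌋-true (v ≟ v) refl) ⟨
      degree G v ℕ.+ indicator ⌊ v ≟ u ⌋ ℕ.+ indicator ⌊ v ≟ v ⌋ ∎
      where
      open ≡-Reasoning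
      Gvu≡false : G v u ≡ false
      Gvu≡false = trans (symmetric v u) Guv≡false
    elsewhere : x ≢ u → x ≢ v → Formula x
    elsewhere x≢u x≢v = begin
      degree (addEdge G u v) x ≡⟨ ℕΣ.Σ-cong (λ y → cong indicator (addEdge-elsewhere x≢u x≢v y)) ⟩
      degree G x             ≡⟨ trans (ℕ.+-identityʳ _) (ℕ.+-identityʳ _) ⟨
      degree G x ℕ.+ 0 ℕ.+ 0 ≡⟨ cong₂ (λ a c → degree G x ℕ.+ indicator a ℕ.+ indicator c) (⌊⌋-false (x ≟ u) x≢u) (⌊⌋-false (x ≟ v) x≢v) ⟨
      degree G x ℕ.+ indicator ⌊ x ≟ u ⌋ ℕ.+ indicator ⌊ x ≟ v ⌋ ∎
      where open ≡-Reasoning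
    by-cases : Dec (x ≡ u) → Dec (x ≡ v) → Formula x
    by-cases (yes x≡u) _ = subst Formula (sym x≡u) at-source
    by-cases (no _) (yes x≡v) = subst Formula (sym x≡v) at-target
    by-cases (no x≢u) (no x≢v) = elsewhere x≢u x≢v

  total-degree-addEdge : Symmetric G → sumℕ (degree (addEdge G u v)) ≡ sumℕ (degree G) ℕ.+ 2
  total-degree-addEdge symmetric = begin
    sumℕ (degree (addEdge G u v))                                                     ≡⟨ ℕΣ.Σ-cong (degree-addEdge symmetric) ⟩
    sumℕ (λ x → degree G x ℕ.+ indicator ⌊ x ≟ u ⌋ ℕ.+ indicator ⌊ x ≟ v ⌋)            ≡⟨ ℕΣ.Σ-distrib {n} _ _ ⟩
    sumℕ (λ x → degree G x ℕ.+ indicator ⌊ x ≟ u ⌋) ℕ.+ sumℕ (λ x → indicator ⌊ x ≟ v ⌋) ≡⟨ cong (ℕ._+ _) (ℕΣ.Σ-distrib {n} _ _) ⟩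
    sumℕ (degree G) ℕ.+ sumℕ (λ x → indicator ⌊ x ≟ u ⌋) ℕ.+ sumℕ (λ x → indicator ⌊ x ≟ v ⌋)
      ≡⟨ cong₂ (λ p q → sumℕ (degree G) ℕ.+ p ℕ.+ q) (point-sum u) (point-sum v) ⟩
    sumℕ (degree G) ℕ.+ 1 ℕ.+ 1                                                        ≡⟨ ℕ.+-assoc (sumℕ (degree G)) 1 1 ⟩
    sumℕ (degree G) ℕ.+ 2                                                              ∎
    where open ≡-Reasoning

  symmetric-addEdge : Symmetric G → Symmetric (addEdge G u v)
  symmetric-addEdge symmetric x y =
    cong₂ _∨_ (symmetric x y)
      (trans (∨-comm (⌊ x ≟ u ⌋ ∧ ⌊ y ≟ v ⌋) _) (cong₂ _∨_ (∧-comm ⌊ x ≟ v ⌋ _) (∧-comm ⌊ x ≟ u ⌋ _)))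

  loopless-addEdge : (∀ x → G x x ≡ false) → ∀ x → addEdge G u v x x ≡ false
  loopless-addEdge loopless x rewrite loopless x with x ≟ u | x ≟ v
  ... | yes x≡u | yes x≡v = ⊥-elim (u≢v (trans (sym x≡u) x≡v))
  ... | yes _ | no _ = refl
  ... | no _ | yes _ = refl
  ... | no _ | no _ = refl

neighbourhood-addEdge-target : ∀ {n} {G : Graph n} → Symmetric G → ∀ {u v ks} → u ≢ v → G u v ≡ false →
  Neighbourhood G v ks → Neighbourhood (addEdge G u v) v (u ∷ ks)
neighbourhood-addEdge-target {G = G} symmetric {u} {v} u≢v Guv≡false nbhd =
  Neighbourhood-cong (addEdge-comm G v u v) (neighbourhood-addEdge-source G (≢-sym u≢v) (trans (symmetric v u) Guv≡false) nbhd)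

T⌊⌋ : ∀ {A : Set} (a? : Dec A) → T ⌊ a? ⌋ ⇔ A
T⌊⌋ a? = mk⇔ toWitness fromWitness

spiderAdjℕ-spec : ∀ b x y →
  T (spiderAdjℕ b x y) ⇔ ((x ≡ 0 × 1 ℕ.≤ y × y ℕ.≤ b) ⊎ (1 ℕ.≤ x × x ℕ.≤ b × y ≡ x ℕ.+ b))
spiderAdjℕ-spec b x y = ⇔.trans T-∨
  (conjunction (T⌊⌋ (x ℕ.≟ 0)) (T⌊⌋ (1 ℕ.≤? y)) (T⌊⌋ (y ℕ.≤? b)) ⊎-⇔
   conjunction (T⌊⌋ (1 ℕ.≤? x)) (T⌊⌋ (x ℕ.≤? b)) (T⌊⌋ (y ℕ.≟ x ℕ.+ b)))
  where
  conjunction : ∀ {p q r : Bool} {P Q R : Set} → T p ⇔ P → T q ⇔ Q → T r ⇔ R → T (p ∧ q ∧ r) ⇔ (P × Q × R)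
  conjunction p⇔P q⇔Q r⇔R = ⇔.trans T-∧ (p⇔P ×-⇔ ⇔.trans T-∧ (q⇔Q ×-⇔ r⇔R))

sumℕ-const : ∀ n c → sumℕ {n} (λ _ → c) ≡ n ℕ.* c
sumℕ-const zero c = refl
sumℕ-const (suc n) c = cong (c ℕ.+_) (sumℕ-const n c)

module Spider (b : ℕ) where

  V : Set
  V = Fin (suc (2 ℕ.* b))

  S : Graph (suc (2 ℕ.* b))
  S = spider2 b

  centre : V
  centre = zero

  -- Leg e is centre — mid e — leaf e, where toℕ (mid e) = 1 + e and toℕ (leaf e) = 1 + b + e.
  mid leaf : Fin b → V
  mid e = suc (e ↑ˡ (b ℕ.+ 0))
  leaf e = suc (b ↑ʳ (e ↑ˡ 0))

  data Vertex : V → Set where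
    at-centre : Vertex centre
    at-mid : ∀ e → Vertex (mid e)
    at-leaf : ∀ e → Vertex (leaf e)

  vertex : ∀ x → Vertex x
  vertex zero = at-centre
  vertex (suc y) with splitAt b y in y≡
  ... | inj₁ e = subst (Vertex ∘ suc) (Fin.splitAt⁻¹-↑ˡ y≡) (at-mid e)
  ... | inj₂ z with splitAt b z in z≡
  ...   | inj₁ e =
    subst (Vertex ∘ suc) (trans (cong (b ↑ʳ_) (Fin.splitAt⁻¹-↑ˡ z≡)) (Fin.splitAt⁻¹-↑ʳ y≡)) (at-leaf e)

  mid-injective : ∀ {e e′} → mid e ≡ mid e′ → e ≡ e′
  mid-injective eq = Fin.↑ˡ-injective _ _ _ (Fin.suc-injective eq)

  leaf-injective : ∀ {e e′} → leaf e ≡ leaf e′ → e ≡ e′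
  leaf-injective eq = Fin.↑ˡ-injective 0 _ _ (Fin.↑ʳ-injective b _ _ (Fin.suc-injective eq))

  mid≢leaf : ∀ e e′ → mid e ≢ leaf e′
  mid≢leaf e e′ eq
    with trans (sym (Fin.splitAt-↑ˡ b e _)) (trans (cong (splitAt b) (Fin.suc-injective eq)) (Fin.splitAt-↑ʳ b _ _))
  ... | ()

  toℕ-mid : ∀ e → toℕ (mid e) ≡ suc (toℕ e)
  toℕ-mid e = cong suc (toℕ-↑ˡ e _)

  toℕ-leaf : ∀ e → toℕ (leaf e) ≡ toℕ (mid e) ℕ.+ b
  toℕ-leaf e =
    cong suc (trans (toℕ-↑ʳ b _) (trans (ℕ.+-comm b _) (cong (ℕ._+ b) (trans (toℕ-↑ˡ e 0) (sym (toℕ-↑ˡ e _))))))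

  mid≤b : ∀ e → toℕ (mid e) ℕ.≤ b
  mid≤b e = subst (ℕ._≤ b) (sym (toℕ-mid e)) (Fin.toℕ<n e)

  Edgeℕ : ℕ → ℕ → Set
  Edgeℕ x y = (x ≡ 0 × 1 ℕ.≤ y × y ℕ.≤ b) ⊎ (1 ℕ.≤ x × x ℕ.≤ b × y ≡ x ℕ.+ b)

  adjacency : ∀ x y → S x y ≡ true ⇔ (Edgeℕ (toℕ x) (toℕ y) ⊎ Edgeℕ (toℕ y) (toℕ x))
  adjacency x y = ⇔.trans (⇔.sym T-≡) (⇔.trans T-∨ (spiderAdjℕ-spec b _ _ ⊎-⇔ spiderAdjℕ-spec b _ _))

  symmetric : Symmetric S
  symmetric x y = ∨-comm (spiderAdjℕ b (toℕ x) (toℕ y)) _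

  loopless : ∀ x → S x x ≡ false
  loopless x = ¬-not (no-loop ∘ Equivalence.to (adjacency x x))
    where
    no-edge : ∀ {n} → ¬ Edgeℕ n n
    no-edge (inj₁ (refl , () , _))
    no-edge {n} (inj₂ (1≤n , n≤b , n≡n+b)) with ℕ.+-cancelˡ-≡ n 0 b (trans (ℕ.+-identityʳ n) n≡n+b)
    ... | refl = ℕ.<-irrefl refl (ℕ.≤-trans 1≤n n≤b)
    no-loop : ¬ (Edgeℕ (toℕ x) (toℕ x) ⊎ Edgeℕ (toℕ x) (toℕ x))
    no-loop (inj₁ edge) = no-edge edge
    no-loop (inj₂ edge) = no-edge edge

  spoke : ∀ e → S (mid e) centre ≡ true
  spoke e = Equivalence.from (adjacency (mid e) centre) (inj₂ (inj₁ (refl , s≤s z≤n , mid≤b e)))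

  limb : ∀ e → S (mid e) (leaf e) ≡ true
  limb e = Equivalence.from (adjacency (mid e) (leaf e)) (inj₁ (inj₂ (s≤s z≤n , mid≤b e , toℕ-leaf e)))

  mid-neighbourhood : ∀ e → Neighbourhood S (mid e) (centre ∷ leaf e ∷ [])
  mid-neighbourhood e = record
    { adjacent = spoke e All.∷ limb e All.∷ All.[]
    ; complete = λ k Sek → neighbours k (Equivalence.to (adjacency (mid e) k) Sek)
    ; distinct = ((λ ()) All.∷ All.[]) AllPairs.∷ All.[] AllPairs.∷ AllPairs.[]
    }
    where
    neighbours : ∀ k → Edgeℕ (toℕ (mid e)) (toℕ k) ⊎ Edgeℕ (toℕ k) (toℕ (mid e)) → k ∈ (centre ∷ leaf e ∷ [])
    neighbours k (inj₁ (inj₁ (() , _)))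
    neighbours k (inj₁ (inj₂ (_ , _ , k≡))) = there (here (toℕ-injective (trans k≡ (sym (toℕ-leaf e)))))
    neighbours k (inj₂ (inj₁ (k≡0 , _))) = here (toℕ-injective k≡0)
    neighbours k (inj₂ (inj₂ (1≤k , _ , e≡k+b))) =
      ⊥-elim (ℕ.<-irrefl refl (ℕ.≤-trans (ℕ.+-monoˡ-≤ b 1≤k) (ℕ.≤-trans (ℕ.≤-reflexive (sym e≡k+b)) (mid≤b e))))

  leaf-neighbourhood : ∀ e → Neighbourhood S (leaf e) (mid e ∷ [])
  leaf-neighbourhood e = record
    { adjacent = trans (symmetric (leaf e) (mid e)) (limb e) All.∷ All.[]
    ; complete = λ k Sek → neighbours k (Equivalence.to (adjacency (leaf e) k) Sek)
    ; distinct = All.[] AllPairs.∷ AllPairs.[]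
    }
    where
    b<leaf : ¬ toℕ (leaf e) ℕ.≤ b
    b<leaf leaf≤b =
      ℕ.<-irrefl refl (ℕ.≤-trans (ℕ.+-monoˡ-≤ b (s≤s z≤n)) (ℕ.≤-trans (ℕ.≤-reflexive (sym (toℕ-leaf e))) leaf≤b))
    neighbours : ∀ k → Edgeℕ (toℕ (leaf e)) (toℕ k) ⊎ Edgeℕ (toℕ k) (toℕ (leaf e)) → k ∈ (mid e ∷ [])
    neighbours k (inj₁ (inj₁ (() , _)))
    neighbours k (inj₁ (inj₂ (_ , leaf≤b , _))) = ⊥-elim (b<leaf leaf≤b)
    neighbours k (inj₂ (inj₁ (_ , _ , leaf≤b))) = ⊥-elim (b<leaf leaf≤b)
    neighbours k (inj₂ (inj₂ (_ , _ , e≡k+b))) =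
      here (toℕ-injective (ℕ.+-cancelʳ-≡ b _ _ (trans (sym e≡k+b) (toℕ-leaf e))))

  legs-sumℕ : (f : V → ℕ) → sumℕ f ≡ f centre ℕ.+ sumℕ (λ e → f (mid e) ℕ.+ f (leaf e))
  legs-sumℕ f = cong (f centre ℕ.+_) (ℕΣ.Σ-double b (f ∘ suc))

  legs-sumℚ : (f : V → ℚ) → sumℚ f ≡ f centre ℚ.+ sumℚ (λ e → f (mid e) ℚ.+ f (leaf e))
  legs-sumℚ f = cong (f centre ℚ.+_) (ℚΣ.Σ-double b (f ∘ suc))

  degree-centre : degree S centre ≡ b
  degree-centre = begin
    degree S centre                                       ≡⟨ legs-sumℕ adjacent-to-centre ⟩
    adjacent-to-centre centre ℕ.+ sumℕ (λ e → adjacent-to-centre (mid e) ℕ.+ adjacent-to-centre (leaf e))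
      ≡⟨ cong₂ ℕ._+_ (cong indicator (loopless centre))
           (ℕΣ.Σ-cong (λ e → cong₂ ℕ._+_ (cong indicator (centre-mid e)) (cong indicator (centre-leaf e)))) ⟩
    sumℕ {b} (λ _ → 1)                                    ≡⟨ sumℕ-const b 1 ⟩
    b ℕ.* 1                                               ≡⟨ ℕ.*-identityʳ b ⟩
    b                                                     ∎
    where
    open ≡-Reasoning
    adjacent-to-centre : V → ℕ
    adjacent-to-centre x = indicator (S centre x)
    centre-mid : ∀ e → S centre (mid e) ≡ true
    centre-mid e = trans (symmetric centre (mid e)) (spoke e)
    centre-leaf : ∀ e → S centre (leaf e) ≡ false
    centre-leaf e = trans (symmetric centre (leaf e))
      (Neighbourhood.nonadjacent (leaf-neighbourhood e) centre λ { (here ()) })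

  total-degree : sumℕ (degree S) ≡ 4 ℕ.* b
  total-degree = begin
    sumℕ (degree S)                                                 ≡⟨ legs-sumℕ (degree S) ⟩
    degree S centre ℕ.+ sumℕ (λ e → degree S (mid e) ℕ.+ degree S (leaf e))
      ≡⟨ cong₂ ℕ._+_ degree-centre (ℕΣ.Σ-cong (λ e → cong₂ ℕ._+_
           (degree-neighbourhood (mid-neighbourhood e)) (degree-neighbourhood (leaf-neighbourhood e)))) ⟩
    b ℕ.+ sumℕ {b} (λ _ → 3)                                         ≡⟨ cong (b ℕ.+_) (sumℕ-const b 3) ⟩
    b ℕ.+ b ℕ.* 3                                                    ≡⟨ solve-ℕ b ⟩
    4 ℕ.* b                                                          ∎
    where
    open ≡-Reasoning
    solve-ℕ : ∀ b → b ℕ.+ b ℕ.* 3 ≡ 4 ℕ.* b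
    solve-ℕ = ℕ-solve-∀

module Legs (b : ℕ) {G : Graph (suc (2 ℕ.* b))} (symmetric : Symmetric G)
  {D-1 : ℕ} (total-degree : sumℕ (degree G) ≡ suc D-1) where

  open Spider b using (V; centre; mid; leaf; legs-sumℚ)
  open RandomWalk G symmetric total-degree

  legWeight : (V → V → ℚ) → Fin b → ℚ
  legWeight m e = hit m centre (mid e) * ℕtoℚ (degree G (mid e)) + hit m centre (leaf e) * ℕtoℚ (degree G (leaf e))

  kemeny-by-legs : ∀ {κ} → IsKemeny G κ → ∃ λ m → IsMFPT G m × κ ≡ D⁻¹ * sumℚ (legWeight m)
  kemeny-by-legs {κ} (m , mfpt , rows) = m , mfpt , (begin
    κ                                                       ≡⟨ rows centre ⟨
    sumℚ-except centre (λ j → m centre j * π G j)           ≡⟨ ℚΣ.Σ-cong from-centre ⟩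
    sumℚ (λ j → hit m centre j * π G j)                     ≡⟨ legs-sumℚ (λ j → hit m centre j * π G j) ⟩
    hit m centre centre * π G centre + sumℚ (λ e → term (mid e) + term (leaf e))
      ≡⟨ cong₂ _+_ (trans (cong (_* π G centre) (hit-diagonal m centre)) (ℚ.*-zeroˡ (π G centre))) (ℚΣ.Σ-cong per-leg) ⟩
    0ℚ + sumℚ (λ e → D⁻¹ * legWeight m e)                    ≡⟨ ℚ.+-identityˡ (sumℚ (λ e → D⁻¹ * legWeight m e)) ⟩
    sumℚ (λ e → D⁻¹ * legWeight m e)                         ≡⟨ sumℚ-scaleˡ D⁻¹ (legWeight m) ⟩
    D⁻¹ * sumℚ (legWeight m)                                 ∎)
    where
    open ≡-Reasoning
    term : V → ℚ
    term j = hit m centre j * π G j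
    from-centre : ∀ j → (if ⌊ j ≟ centre ⌋ then 0ℚ else m centre j * π G j) ≡ term j
    from-centre j with j ≟ centre
    ... | yes refl = sym (trans (cong (_* π G centre) (hit-diagonal m centre)) (ℚ.*-zeroˡ (π G centre)))
    ... | no j≢centre = cong (_* π G j) (sym (hit-off-diagonal m (≢-sym j≢centre)))
    regroup : ∀ a d a′ d′ ι → a * (d * ι) + a′ * (d′ * ι) ≡ ι * (a * d + a′ * d′)
    regroup a d a′ d′ ι = solve (a ∷ d ∷ a′ ∷ d′ ∷ ι ∷ []) ℚ-ring
    per-leg : ∀ e → term (mid e) + term (leaf e) ≡ D⁻¹ * legWeight m e
    per-leg e = trans
      (cong₂ (λ p q → hit m centre (mid e) * p + hit m centre (leaf e) * q) (π≡degree*D⁻¹ (mid e)) (π≡degree*D⁻¹ (leaf e)))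
      (regroup (hit m centre (mid e)) (ℕtoℚ (degree G (mid e))) (hit m centre (leaf e)) (ℕtoℚ (degree G (leaf e))) D⁻¹)

  legWeight-from : ∀ {m e xs ys a a′} → Neighbourhood G (mid e) xs → Neighbourhood G (leaf e) ys →
    hit m centre (mid e) ≡ a → hit m centre (leaf e) ≡ a′ →
    legWeight m e ≡ a * ℕtoℚ (length xs) + a′ * ℕtoℚ (length ys)
  legWeight-from mid-nbhd leaf-nbhd h h′ =
    cong₂ _+_ (cong₂ _*_ h (cong ℕtoℚ (degree-neighbourhood mid-nbhd)))
              (cong₂ _*_ h′ (cong ℕtoℚ (degree-neighbourhood leaf-nbhd)))

  Ordinary : Fin b → Set
  Ordinary e = Neighbourhood G (mid e) (centre ∷ leaf e ∷ []) × Neighbourhood G (leaf e) (mid e ∷ [])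

  module _ (loopless : ∀ x → G x x ≡ false) where

    ordinary-legWeight : ∀ {m} → IsMFPT G m → ∀ {e} → Ordinary e → legWeight m e ≡ 4 * D - 10
    ordinary-legWeight {m} mfpt {e} (mid-nbhd , leaf-nbhd) = begin
      legWeight m e                  ≡⟨ uncurry (legWeight-from {m = m} mid-nbhd leaf-nbhd) (pendant-path mid-nbhd leaf-nbhd) ⟩
      (D - 3) * 2 + (2 * D - 4) * 1  ≡⟨ simplify D ⟩
      4 * D - 10                     ∎
      where
      open ≡-Reasoning
      open Configurations G symmetric total-degree loopless mfpt using (pendant-path)
      simplify : ∀ D → (D - 3) * 2 + (2 * D - 4) * 1 ≡ 4 * D - 10
      simplify D = solve (D ∷ []) ℚ-ring

    kemeny-by-exceptional-legs : ∀ {κ} → IsKemeny G κ → ∀ {exceptional} → Unique exceptional →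
      (∀ e → e ∉ exceptional → Ordinary e) →
      ∃ λ m → IsMFPT G m × κ ≡ D⁻¹ * (ℕtoℚ b * (4 * D - 10) + listΣ (λ e → legWeight m e - (4 * D - 10)) exceptional)
    kemeny-by-exceptional-legs kemeny distinct ordinary =
      map₂ (λ {m} (mfpt , κ≡) → mfpt , trans κ≡ (cong (D⁻¹ *_)
        (sumℚ-nearly-constant (legWeight m) (4 * D - 10) distinct (λ e e∉ → ordinary-legWeight mfpt (ordinary e e∉)))))
        (kemeny-by-legs kemeny)

not-increased : ∀ {κ κ′ c t} → κ ≡ κ′ + c * t → 0ℚ ℚ.≤ c → 0ℚ ℚ.≤ t → ¬ κ ℚ.< κ′
not-increased {κ} {κ′} {c} {t} κ≡ 0≤c 0≤t κ<κ′ = ℚ.<-irrefl refl (ℚ.<-≤-trans κ<κ′ κ′≤κ)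
  where
  open ℚ.≤-Reasoning
  κ′≤κ : κ′ ℚ.≤ κ
  κ′≤κ = begin
    κ′         ≡⟨ ℚ.+-identityʳ κ′ ⟨
    κ′ + 0ℚ    ≤⟨ ℚ.+-monoʳ-≤ κ′ (0≤* 0≤c 0≤t) ⟩
    κ′ + c * t ≡⟨ κ≡ ⟨
    κ          ∎

-- With D = 4b + 2, D·(4b − 5/2) − b·(4D − 10) = −5 for every b: only the excess E
-- of the modified legs decides the sign of κ − κ′.
kemeny-gap : ∀ β κ κ′ D D⁻¹ E → κ ≡ 4 * β - 5 / 2 → κ′ ≡ D⁻¹ * (β * (4 * D - 10) + E) → D ≡ 4 * β + 2 →
  D * D⁻¹ ≡ 1ℚ → κ ≡ κ′ + D⁻¹ * (-5 - E)
kemeny-gap β κ κ′ D D⁻¹ E h₁ h₂ h₃ h₄ =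
  linear-combination (1 ⋆ h₁ ⊕ -1 ⋆ h₂ ⊕ -5 / 2 * D⁻¹ ⋆ h₃ ⊕ (5 / 2 - 4 * β) ⋆ h₄)
    (solve (β ∷ κ ∷ κ′ ∷ D ∷ D⁻¹ ∷ E ∷ []) ℚ-ring)

kemeny-spider : ∀ b′ {κ} → IsKemeny (spider2 (suc b′)) κ → κ ≡ 4 * ℕtoℚ (suc b′) - 5 / 2
kemeny-spider b′ {κ} kemeny = solve-κ κ (ℕtoℚ (suc b′)) D D⁻¹ κ≡ D≡ D*D⁻¹
  where
  open Spider (suc b′)
  open RandomWalk S symmetric total-degree
  open Legs (suc b′) symmetric total-degree
  κ≡ : κ ≡ D⁻¹ * (ℕtoℚ (suc b′) * (4 * D - 10) + 0ℚ)
  κ≡ = proj₂ (proj₂ (kemeny-by-exceptional-legs loopless kemeny AllPairs.[]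
    (λ e _ → mid-neighbourhood e , leaf-neighbourhood e)))
  D≡ : D ≡ ℕtoℚ 4 * ℕtoℚ (suc b′)
  D≡ = ℕtoℚ-* 4 (suc b′)
  solve-κ : ∀ κ β D D⁻¹ → κ ≡ D⁻¹ * (β * (4 * D - 10) + 0ℚ) → D ≡ ℕtoℚ 4 * β → D * D⁻¹ ≡ 1ℚ →
    κ ≡ 4 * β - 5 / 2
  solve-κ κ β D D⁻¹ h₁ h₂ h₃ =
    linear-combination (1 ⋆ h₁ ⊕ 5 / 2 * D⁻¹ ⋆ h₂ ⊕ (4 * β - 5 / 2) ⋆ h₃)
      (solve (κ ∷ β ∷ D ∷ D⁻¹ ∷ []) ℚ-ring)

module EdgeAdded (b′ : ℕ) {u v} (u≢v : u ≢ v) (Suv≡false : Spider.S (suc b′) u v ≡ false) where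

  open Spider (suc b′)

  G′ : Graph (suc (2 ℕ.* suc b′))
  G′ = addEdge S u v

  symmetric′ : Symmetric G′
  symmetric′ = symmetric-addEdge S u≢v Suv≡false symmetric

  loopless′ : ∀ x → G′ x x ≡ false
  loopless′ = loopless-addEdge S u≢v Suv≡false loopless

  total-degree′ : sumℕ (degree G′) ≡ 4 ℕ.* suc b′ ℕ.+ 2
  total-degree′ = trans (total-degree-addEdge S u≢v Suv≡false symmetric) (cong (ℕ._+ 2) total-degree)

  open RandomWalk G′ symmetric′ total-degree′ public
  open Legs (suc b′) symmetric′ total-degree′ public

  D≡ : D ≡ ℕtoℚ 4 * ℕtoℚ (suc b′) + ℕtoℚ 2
  D≡ = trans (ℕtoℚ-+ (4 ℕ.* suc b′) 2) (cong (_+ ℕtoℚ 2) (ℕtoℚ-* 4 (suc b′)))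

  D≡4b′+6 : D ≡ 4 * ℕtoℚ b′ + 6
  D≡4b′+6 = trans D≡ (trans (cong (λ β → ℕtoℚ 4 * β + ℕtoℚ 2) (ℕtoℚ-+ 1 b′)) (shift (ℕtoℚ b′)))
    where
    shift : ∀ β′ → ℕtoℚ 4 * (ℕtoℚ 1 + β′) + ℕtoℚ 2 ≡ 4 * β′ + 6
    shift β′ = solve (β′ ∷ []) ℚ-ring

  neighbourhood-elsewhere : ∀ {x ks} → x ≢ u → x ≢ v → Neighbourhood S x ks → Neighbourhood G′ x ks
  neighbourhood-elsewhere = neighbourhood-addEdge-elsewhere S u≢v Suv≡false

  neighbourhood-u : ∀ {ks} → Neighbourhood S u ks → Neighbourhood G′ u (v ∷ ks)
  neighbourhood-u = neighbourhood-addEdge-source S u≢v Suv≡false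

  neighbourhood-v : ∀ {ks} → Neighbourhood S v ks → Neighbourhood G′ v (u ∷ ks)
  neighbourhood-v = neighbourhood-addEdge-target symmetric u≢v Suv≡false

  excess : (V → V → ℚ) → List (Fin (suc b′)) → ℚ
  excess m = listΣ (λ e → legWeight m e - (4 * D - 10))

  no-braess-if : ∀ {exceptional} → Unique exceptional → (∀ e → e ∉ exceptional → Ordinary e) →
    (∀ {m} → IsMFPT G′ m → 0ℚ ℚ.≤ -5 - excess m exceptional) → ¬ IsBraess S u v
  no-braess-if {exceptional} distinct ordinary bound (_ , _ , κ , κ′ , kemeny , kemeny′ , κ<κ′) =
    refute (kemeny-by-exceptional-legs loopless′ kemeny′ distinct ordinary)
    where
    refute : (∃ λ m → IsMFPT G′ m × κ′ ≡ D⁻¹ * (ℕtoℚ (suc b′) * (4 * D - 10) + excess m exceptional)) → ⊥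
    refute (m , mfpt , κ′≡) = not-increased
      (kemeny-gap (ℕtoℚ (suc b′)) κ κ′ D D⁻¹ (excess m exceptional) (kemeny-spider b′ kemeny) κ′≡ D≡ D*D⁻¹)
      0≤D⁻¹ (bound mfpt) κ<κ′

distinct-pair : ∀ {A : Set} {p q : A} → p ≢ q → Unique (p ∷ q ∷ [])
distinct-pair p≢q = (p≢q All.∷ All.[]) AllPairs.∷ All.[] AllPairs.∷ AllPairs.[]

module NoBraessEdge (b′ : ℕ) where

  open Spider (suc b′)

  centre-leaf : ∀ p → ¬ IsBraess S centre (leaf p)
  centre-leaf p braess@(u≢v , Suv≡false , _) =
    no-braess-if (All.[] AllPairs.∷ AllPairs.[]) ordinary bound braess
    where
    open EdgeAdded b′ u≢v Suv≡false
    mid-nbhd : Neighbourhood G′ (mid p) (centre ∷ leaf p ∷ [])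
    mid-nbhd = neighbourhood-elsewhere (λ ()) (mid≢leaf p p) (mid-neighbourhood p)
    leaf-nbhd : Neighbourhood G′ (leaf p) (centre ∷ mid p ∷ [])
    leaf-nbhd = neighbourhood-v (leaf-neighbourhood p)
    ordinary : ∀ e → e ∉ p ∷ [] → Ordinary e
    ordinary e e∉ = neighbourhood-elsewhere (λ ()) (mid≢leaf e p) (mid-neighbourhood e) ,
                    neighbourhood-elsewhere (λ ()) (λ eq → e∉ (here (leaf-injective eq))) (leaf-neighbourhood e)
    bound : ∀ {m} → IsMFPT G′ m → 0ℚ ℚ.≤ -5 - excess m (p ∷ [])
    bound {m} mfpt = subst (0ℚ ℚ.≤_) (sym gap)
      (0≤+ (0≤* (ℚ.nonNegative⁻¹ (16 / 3)) (0≤ℕtoℚ b′)) (ℚ.nonNegative⁻¹ 1))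
      where
      open Configurations G′ symmetric′ total-degree′ loopless′ mfpt
      weight : legWeight m p ≡ (2 / 3 * D - 2) * ℕtoℚ 2 + (2 / 3 * D - 2) * ℕtoℚ 2
      weight = legWeight-from {m = m} mid-nbhd leaf-nbhd (triangle mid-nbhd leaf-nbhd) (triangle leaf-nbhd mid-nbhd)
      solve-gap : ∀ D β′ w → w ≡ (2 / 3 * D - 2) * ℕtoℚ 2 + (2 / 3 * D - 2) * ℕtoℚ 2 → D ≡ 4 * β′ + 6 →
        -5 - (w - (4 * D - 10) + 0ℚ) ≡ 16 / 3 * β′ + 1
      solve-gap D β′ w h₁ h₂ = linear-combination (-1 ⋆ h₁ ⊕ 4 / 3 ⋆ h₂) (solve (D ∷ β′ ∷ w ∷ []) ℚ-ring)
      gap : -5 - excess m (p ∷ []) ≡ 16 / 3 * ℕtoℚ b′ + 1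
      gap = solve-gap D (ℕtoℚ b′) (legWeight m p) weight D≡4b′+6

  mid-mid : ∀ {p q} → p ≢ q → ¬ IsBraess S (mid p) (mid q)
  mid-mid {p} {q} p≢q braess@(u≢v , Suv≡false , _) =
    no-braess-if (distinct-pair p≢q) ordinary bound braess
    where
    open EdgeAdded b′ u≢v Suv≡false
    mid-p : Neighbourhood G′ (mid p) (mid q ∷ centre ∷ leaf p ∷ [])
    mid-p = neighbourhood-u (mid-neighbourhood p)
    mid-q : Neighbourhood G′ (mid q) (mid p ∷ centre ∷ leaf q ∷ [])
    mid-q = neighbourhood-v (mid-neighbourhood q)
    leaf-p : Neighbourhood G′ (leaf p) (mid p ∷ [])
    leaf-p = neighbourhood-elsewhere (≢-sym (mid≢leaf p p)) (≢-sym (mid≢leaf q p)) (leaf-neighbourhood p)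
    leaf-q : Neighbourhood G′ (leaf q) (mid q ∷ [])
    leaf-q = neighbourhood-elsewhere (≢-sym (mid≢leaf p q)) (≢-sym (mid≢leaf q q)) (leaf-neighbourhood q)
    ordinary : ∀ e → e ∉ p ∷ q ∷ [] → Ordinary e
    ordinary e e∉ =
      neighbourhood-elsewhere (λ eq → e∉ (here (mid-injective eq))) (λ eq → e∉ (there (here (mid-injective eq))))
        (mid-neighbourhood e) ,
      neighbourhood-elsewhere (≢-sym (mid≢leaf p e)) (≢-sym (mid≢leaf q e)) (leaf-neighbourhood e)
    bound : ∀ {m} → IsMFPT G′ m → 0ℚ ℚ.≤ -5 - excess m (p ∷ q ∷ [])
    bound {m} mfpt = subst (0ℚ ℚ.≤_) (sym gap)
      (0≤+ (0≤* (ℚ.nonNegative⁻¹ (8 / 3)) (0≤ℕtoℚ b′)) (ℚ.nonNegative⁻¹ 13))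
      where
      open Configurations G′ symmetric′ total-degree′ loopless′ mfpt
      weight-p : legWeight m p ≡ (2 / 3 * D - 4) * ℕtoℚ 3 + (5 / 3 * D - 5) * ℕtoℚ 1
      weight-p = uncurry (legWeight-from {m = m} mid-p leaf-p)
        (bridged-legs mid-p leaf-p mid-q leaf-q (mid≢leaf p q) (≢-sym (mid≢leaf q p)) (λ eq → p≢q (leaf-injective eq)))
      weight-q : legWeight m q ≡ (2 / 3 * D - 4) * ℕtoℚ 3 + (5 / 3 * D - 5) * ℕtoℚ 1
      weight-q = uncurry (legWeight-from {m = m} mid-q leaf-q)
        (bridged-legs mid-q leaf-q mid-p leaf-p (mid≢leaf q p) (≢-sym (mid≢leaf p q)) (λ eq → p≢q (sym (leaf-injective eq))))
      solve-gap : ∀ D β′ w w′ → w ≡ (2 / 3 * D - 4) * ℕtoℚ 3 + (5 / 3 * D - 5) * ℕtoℚ 1 →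
        w′ ≡ (2 / 3 * D - 4) * ℕtoℚ 3 + (5 / 3 * D - 5) * ℕtoℚ 1 → D ≡ 4 * β′ + 6 →
        -5 - (w - (4 * D - 10) + (w′ - (4 * D - 10) + 0ℚ)) ≡ 8 / 3 * β′ + 13
      solve-gap D β′ w w′ h₁ h₂ h₃ =
        linear-combination (-1 ⋆ h₁ ⊕ -1 ⋆ h₂ ⊕ 2 / 3 ⋆ h₃) (solve (D ∷ β′ ∷ w ∷ w′ ∷ []) ℚ-ring)
      gap : -5 - excess m (p ∷ q ∷ []) ≡ 8 / 3 * ℕtoℚ b′ + 13
      gap = solve-gap D (ℕtoℚ b′) (legWeight m p) (legWeight m q) weight-p weight-q D≡4b′+6

  mid-leaf : ∀ {p q} → p ≢ q → ¬ IsBraess S (mid p) (leaf q)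
  mid-leaf {p} {q} p≢q braess@(u≢v , Suv≡false , _) = no-braess-if (distinct-pair p≢q) ordinary bound braess
    where
    open EdgeAdded b′ u≢v Suv≡false
    mid-p : Neighbourhood G′ (mid p) (leaf q ∷ centre ∷ leaf p ∷ [])
    mid-p = neighbourhood-u (mid-neighbourhood p)
    leaf-q : Neighbourhood G′ (leaf q) (mid p ∷ mid q ∷ [])
    leaf-q = neighbourhood-v (leaf-neighbourhood q)
    leaf-p : Neighbourhood G′ (leaf p) (mid p ∷ [])
    leaf-p = neighbourhood-elsewhere (≢-sym (mid≢leaf p p)) (λ eq → p≢q (leaf-injective eq)) (leaf-neighbourhood p)
    mid-q : Neighbourhood G′ (mid q) (centre ∷ leaf q ∷ [])
    mid-q = neighbourhood-elsewhere (λ eq → p≢q (sym (mid-injective eq))) (mid≢leaf q q) (mid-neighbourhood q)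
    ordinary : ∀ e → e ∉ p ∷ q ∷ [] → Ordinary e
    ordinary e e∉ =
      neighbourhood-elsewhere (λ eq → e∉ (here (mid-injective eq))) (mid≢leaf e q) (mid-neighbourhood e) ,
      neighbourhood-elsewhere (≢-sym (mid≢leaf p e)) (λ eq → e∉ (there (here (leaf-injective eq)))) (leaf-neighbourhood e)
    bound : ∀ {m} → IsMFPT G′ m → 0ℚ ℚ.≤ -5 - excess m (p ∷ q ∷ [])
    bound {m} mfpt = subst (0ℚ ℚ.≤_) (sym gap)
      (0≤+ (0≤* (ℚ.nonNegative⁻¹ 2) (0≤ℕtoℚ b′)) (ℚ.nonNegative⁻¹ 14))
      where
      open Configurations G′ symmetric′ total-degree′ loopless′ mfpt
      legs : (hit m centre (mid p) ≡ 3 / 4 * D - 9 / 2 × hit m centre (leaf p) ≡ 7 / 4 * D - 11 / 2) ×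
             (hit m centre (mid q) ≡ 3 / 4 * D - 7 / 2 × hit m centre (leaf q) ≡ D - 5)
      legs = mid-to-leaf mid-p leaf-p leaf-q mid-q
        (λ eq → p≢q (mid-injective eq)) (λ eq → p≢q (leaf-injective eq)) (≢-sym (mid≢leaf q p))
      weight-p : legWeight m p ≡ (3 / 4 * D - 9 / 2) * ℕtoℚ 3 + (7 / 4 * D - 11 / 2) * ℕtoℚ 1
      weight-p = uncurry (legWeight-from {m = m} mid-p leaf-p) (proj₁ legs)
      weight-q : legWeight m q ≡ (3 / 4 * D - 7 / 2) * ℕtoℚ 2 + (D - 5) * ℕtoℚ 2
      weight-q = uncurry (legWeight-from {m = m} mid-q leaf-q) (proj₂ legs)
      solve-gap : ∀ D β′ w w′ → w ≡ (3 / 4 * D - 9 / 2) * ℕtoℚ 3 + (7 / 4 * D - 11 / 2) * ℕtoℚ 1 →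
        w′ ≡ (3 / 4 * D - 7 / 2) * ℕtoℚ 2 + (D - 5) * ℕtoℚ 2 → D ≡ 4 * β′ + 6 →
        -5 - (w - (4 * D - 10) + (w′ - (4 * D - 10) + 0ℚ)) ≡ 2 * β′ + 14
      solve-gap D β′ w w′ h₁ h₂ h₃ =
        linear-combination (-1 ⋆ h₁ ⊕ -1 ⋆ h₂ ⊕ 1 / 2 ⋆ h₃) (solve (D ∷ β′ ∷ w ∷ w′ ∷ []) ℚ-ring)
      gap : -5 - excess m (p ∷ q ∷ []) ≡ 2 * ℕtoℚ b′ + 14
      gap = solve-gap D (ℕtoℚ b′) (legWeight m p) (legWeight m q) weight-p weight-q D≡4b′+6

  leaf-leaf : ∀ {p q} → p ≢ q → ¬ IsBraess S (leaf p) (leaf q)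
  leaf-leaf {p} {q} p≢q braess@(u≢v , Suv≡false , _) = no-braess-if (distinct-pair p≢q) ordinary bound braess
    where
    open EdgeAdded b′ u≢v Suv≡false
    leaf-p : Neighbourhood G′ (leaf p) (leaf q ∷ mid p ∷ [])
    leaf-p = neighbourhood-u (leaf-neighbourhood p)
    leaf-q : Neighbourhood G′ (leaf q) (leaf p ∷ mid q ∷ [])
    leaf-q = neighbourhood-v (leaf-neighbourhood q)
    mid-p : Neighbourhood G′ (mid p) (centre ∷ leaf p ∷ [])
    mid-p = neighbourhood-elsewhere (mid≢leaf p p) (mid≢leaf p q) (mid-neighbourhood p)
    mid-q : Neighbourhood G′ (mid q) (centre ∷ leaf q ∷ [])
    mid-q = neighbourhood-elsewhere (mid≢leaf q p) (mid≢leaf q q) (mid-neighbourhood q)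
    ordinary : ∀ e → e ∉ p ∷ q ∷ [] → Ordinary e
    ordinary e e∉ =
      neighbourhood-elsewhere (mid≢leaf e p) (mid≢leaf e q) (mid-neighbourhood e) ,
      neighbourhood-elsewhere (λ eq → e∉ (here (leaf-injective eq))) (λ eq → e∉ (there (here (leaf-injective eq))))
        (leaf-neighbourhood e)
    bound : ∀ {m} → IsMFPT G′ m → 0ℚ ℚ.≤ -5 - excess m (p ∷ q ∷ [])
    bound {m} mfpt = subst (0ℚ ℚ.≤_) (sym gap)
      (ℚ.nonNegative⁻¹ 15)
      where
      open Configurations G′ symmetric′ total-degree′ loopless′ mfpt
      weight-p : legWeight m p ≡ (4 / 5 * D - 4) * ℕtoℚ 2 + (6 / 5 * D - 6) * ℕtoℚ 2
      weight-p = uncurry (legWeight-from {m = m} mid-p leaf-p)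
        (pentagon mid-p leaf-p leaf-q mid-q (mid≢leaf p q) (λ eq → p≢q (mid-injective eq)) (≢-sym (mid≢leaf q p)))
      weight-q : legWeight m q ≡ (4 / 5 * D - 4) * ℕtoℚ 2 + (6 / 5 * D - 6) * ℕtoℚ 2
      weight-q = uncurry (legWeight-from {m = m} mid-q leaf-q)
        (pentagon mid-q leaf-q leaf-p mid-p (mid≢leaf q p) (λ eq → p≢q (sym (mid-injective eq))) (≢-sym (mid≢leaf p q)))
      solve-gap : ∀ D w w′ → w ≡ (4 / 5 * D - 4) * ℕtoℚ 2 + (6 / 5 * D - 6) * ℕtoℚ 2 →
        w′ ≡ (4 / 5 * D - 4) * ℕtoℚ 2 + (6 / 5 * D - 6) * ℕtoℚ 2 →
        -5 - (w - (4 * D - 10) + (w′ - (4 * D - 10) + 0ℚ)) ≡ 15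
      solve-gap D w w′ h₁ h₂ = linear-combination (-1 ⋆ h₁ ⊕ -1 ⋆ h₂) (solve (D ∷ w ∷ w′ ∷ []) ℚ-ring)
      gap : -5 - excess m (p ∷ q ∷ []) ≡ 15
      gap = solve-gap D (legWeight m p) (legWeight m q) weight-p weight-q

  adjacent-not-braess : ∀ {u v} → S u v ≡ true → ¬ IsBraess S u v
  adjacent-not-braess Suv≡true (_ , Suv≡false , _) = true≢false (trans (sym Suv≡true) Suv≡false)
    where
    true≢false : true ≢ false
    true≢false ()

  mid-leaf′ : ∀ {p q} → Dec (p ≡ q) → ¬ IsBraess S (mid p) (leaf q)
  mid-leaf′ {p} (yes refl) = adjacent-not-braess (limb p)
  mid-leaf′ (no p≢q) = mid-leaf p≢q

  mid-mid′ : ∀ {p q} → Dec (p ≡ q) → ¬ IsBraess S (mid p) (mid q)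
  mid-mid′ (yes refl) (u≢v , _) = u≢v refl
  mid-mid′ (no p≢q) = mid-mid p≢q

  leaf-leaf′ : ∀ {p q} → Dec (p ≡ q) → ¬ IsBraess S (leaf p) (leaf q)
  leaf-leaf′ (yes refl) (u≢v , _) = u≢v refl
  leaf-leaf′ (no p≢q) = leaf-leaf p≢q

  no-braess : ∀ {u v} → Vertex u → Vertex v → ¬ IsBraess S u v
  no-braess at-centre at-centre (u≢v , _) = u≢v refl
  no-braess at-centre (at-mid e) = adjacent-not-braess (trans (symmetric centre (mid e)) (spoke e))
  no-braess at-centre (at-leaf p) = centre-leaf p
  no-braess (at-mid e) at-centre = adjacent-not-braess (spoke e)
  no-braess (at-mid p) (at-mid q) = mid-mid′ (p ≟ q)
  no-braess (at-mid p) (at-leaf q) = mid-leaf′ (p ≟ q)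
  no-braess (at-leaf p) at-centre = centre-leaf p ∘ IsBraess-sym symmetric
  no-braess (at-leaf q) (at-mid p) = mid-leaf′ (p ≟ q) ∘ IsBraess-sym symmetric
  no-braess (at-leaf p) (at-leaf q) = leaf-leaf′ (p ≟ q)

corollary4p6 : (b : ℕ) → 2 ≤ b → (u v : Fin _) → ¬ IsBraess (spider2 b) u v
corollary4p6 zero () u v
corollary4p6 (suc b′) _ u v = NoBraessEdge.no-braess b′ (Spider.vertex (suc b′) u) (Spider.vertex (suc b′) v)
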